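{- Let $K$ be a field, $X$ a $K$-valued vertex-weighted connected finite graph with $n$ vertices, $S\subseteq\mathbb{E}(X)$ a set containing exactly one edge from each pair $\{e,\bar e\}$, $v\in V(X)$, and $A\subseteq S$ with $\#A=n-1$. Let $\bm{B}_X[\{v\},S\setminus A]$ be the square submatrix of $\bm{B}_X$ with rows $V(X)\setminus\{v\}$ and columns $A$, and let $\widetilde A$ be the subgraph with vertex set $V(X)$ and edge set $A\cup\{\bar e:e\in A\}$. Then: (1) if $\widetilde A$ is not a tree, $\det\bigl(\bm{B}_X[\{v\},S\setminus A]\bigr)=0$; (2) if $\widetilde A$ is a tree, $\det\bigl(\bm{B}_X[\{v\},S\setminus A]\bigr)^2=w\bigl((\widetilde A)_v\bigr)$.
   Context: A graph $X$: finite sets $V(X)$, $\mathbb{E}(X)$, maps $o,t$, involution $e\mapsto\bar e$ with $\bar e\ne e$, $o(\bar e)=t(e)$; loops and multiple edges allowed. A cycle is a closed trail (each undirected edge $\{e,\bar e\}$ used at most once) of length $l$ visiting exactly $l$ distinct vertices (loops and parallel pairs are cycles); a tree is a connected bar-closed graph with no cycles; $d_T$ is the path distance in a tree $T$, and $\mathbb{E}(T_v)=\{e\in\mathbb{E}(T):d_T(v,o(e))>d_T(v,t(e))\}$. Weights $w\colon V(X)\to K$, square roots $\sqrt{w_u}$ fixed in $\bar K$; $w(T_v)=\prod_{e\in\mathbb{E}(T_v)}w_{t(e)}$. $\bm{B}_X$ has rows indexed by $V(X)$, columns by $S$, with $\bm{B}_X(u,e)=\sqrt{w_{t(e)}}$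 if $o(e)\ne t(e)$, $o(e)=u$; $=-\sqrt{w_{o(e)}}$ if $o(e)\ne t(e)$, $t(e)=u$; $=0$ otherwise. A $0\times0$ determinant is $1$. -}

module Defs where

open import Level using (Level; _⊔_)
open import Data.Nat using (ℕ; zero; suc; _≤_; _<?_)
open import Data.Fin using (Fin; zero; suc; punchIn; inject₁; fromℕ; _≟_)
open import Data.Bool using (Bool; true; false; if_then_else_; _∧_; _∨_; T)
open import Data.Product using (Σ; ∃; _×_; _,_)
open import Relation.Nullary using (¬_)
open import Relation.Nullary.Decidable using (⌊_⌋)
open import Relation.Binary.PropositionalEquality using (_≡_; _≢_)
open import Algebra.Bundles using (CommutativeRing)

IsField : ∀ {c ℓ} → CommutativeRing c ℓ → Set (c ⊔ ℓ)
IsField R = ¬ (1# ≈ 0#) × (∀ x → ¬ (x ≈ 0#) → Σ Carrier λ y → x * y ≈ 1#)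
  where open CommutativeRing R

-- Finite graphs (Serre style): vertices Fin n, oriented edges Fin m,
-- origin/terminus maps o,t and a fixed-point-free involution bar with
-- o (bar e) = t e.  Loops and multiple edges are allowed.

record Graph (n m : ℕ) : Set where
  field
    o t     : Fin m → Fin n
    bar     : Fin m → Fin m
    bar-inv : ∀ e → bar (bar e) ≡ e
    bar-ne  : ∀ e → bar e ≢ e
    o-bar   : ∀ e → o (bar e) ≡ t e

module _ {n m : ℕ} (X : Graph n m) where
  open Graph X

  data Walk (P : Fin m → Set) : Fin n → Fin n → ℕ → Set where
    nil  : ∀ {u} → Walk P u u zero
    cons : ∀ {x k} (e : Fin m) → P e → Walk P (t e) x k → Walk P (o e) x (suc k)

  Connected : (Fin m → Set) → Set
  Connected P = ∀ u x → ∃ λ k → Walk P u x k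

  IsCycle : (Fin m → Set) → (l : ℕ) → (Fin (suc l) → Fin m) → Set
  IsCycle P l c =
    (∀ i → P (c i)) ×
    (∀ (i : Fin l) → t (c (inject₁ i)) ≡ o (c (suc i))) ×
    (t (c (fromℕ l)) ≡ o (c zero)) ×
    (∀ i j → i ≢ j → (c i ≢ c j) × (c i ≢ bar (c j))) ×
    (∀ i j → o (c i) ≡ o (c j) → i ≡ j)

  -- the subgraph (V(X), {e : P e}) (assumed bar-closed) is a tree
  IsTree : (Fin m → Set) → Set
  IsTree P = Connected P × (∀ l c → ¬ IsCycle P l c)

  IsDistFrom : (Fin m → Set) → Fin n → (Fin n → ℕ) → Set
  IsDistFrom P v d = ∀ x → Walk P v x (d x) × (∀ k → Walk P v x k → d x ≤ k)

  -- Boolean membership in the edge set A ∪ {bar e : e ∈ A} of Ã,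
  -- where A is given as the image of a : Fin p → edges
  anyFin : ∀ {p} → (Fin p → Bool) → Bool
  anyFin {zero}  f = false
  anyFin {suc p} f = f zero ∨ anyFin {p} (λ j → f (suc j))

  inTildeᵇ : ∀ {p} → (Fin p → Fin m) → Fin m → Bool
  inTildeᵇ a e = anyFin (λ j → ⌊ a j ≟ e ⌋ ∨ ⌊ a j ≟ bar e ⌋)

  Tilde : ∀ {p} → (Fin p → Fin m) → Fin m → Set
  Tilde a e = T (inTildeᵇ a e)

module RingDefs {c ℓ} (R : CommutativeRing c ℓ) where
  open CommutativeRing R hiding (zero)

  prodFin : ∀ {k} → (Fin k → Carrier) → Carrier
  prodFin {zero}  f = 1#
  prodFin {suc k} f = f zero * prodFin (λ j → f (suc j))

  altSum : ∀ {k} → (Fin k → Carrier) → Carrier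
  altSum {zero}  f = 0#
  altSum {suc k} f = f zero - altSum (λ j → f (suc j))

  det : ∀ k → (Fin k → Fin k → Carrier) → Carrier
  det zero    M = 1#
  det (suc k) M = altSum (λ j → M zero j * det k (λ i i' → M (suc i) (punchIn j i')))

  module _ {n m : ℕ} (X : Graph n m) where
    open Graph X

    -- the matrix B_X (all columns, i.e. all oriented edges); sq u is the
    -- fixed square root of the weight of u
    Bmat : (Fin n → Carrier) → Fin n → Fin m → Carrier
    Bmat sq u e with o e ≟ t e
    ... | Relation.Nullary.yes _ = 0#
    ... | Relation.Nullary.no _ =
      if ⌊ o e ≟ u ⌋ then sq (t e)
      else if ⌊ t e ≟ u ⌋ then - sq (o e)
      else 0#

    -- w(T_v) for T = Ã, with d the distance from v in Ã:
    -- product over edges e of Ã with d(o e) > d(t e) of w_{t e}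
    wTv : ∀ {p} → (Fin n → Carrier) → (Fin p → Fin m) → (Fin n → ℕ) → Carrier
    wTv w a d = prodFin (λ e →
      if inTildeᵇ X a e ∧ ⌊ d (t e) <? d (o e) ⌋ then w (t e) else 1#)

  -- B_X[{v}, S \ A]: rows V(X) \ {v} (enumerated by punchIn v),
  -- columns A (enumerated by a)
  subB : ∀ {p m} (X : Graph (suc p) m) → (Fin (suc p) → Carrier) →
         Fin (suc p) → (Fin p → Fin m) → Fin p → Fin p → Carrier
  subB X sq v a i j = Bmat X sq (punchIn v i) (a j)

{-# OPTIONS --safe #-}

-- Laplace expansion of B = B_X[{v}, S∖A] along the row of a vertex x that meets a single edge e
-- of A leaves the same kind of matrix for A∖{e} without x. If Ã is a tree, expand repeatedly
-- along the vertex farthest from v: the entry used is ±√w_y for the parent y of x, so the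
-- squares of the entries multiply to w(Ã_v). If Ã is not a tree, such leaf removal gets stuck
-- either at a row meeting no edge, or at a square matrix whose row vertices all meet at least
-- two edges, so that by counting every column has both ends among the rows; for unit weights
-- these rows then sum to zero. General weights reduce to unit ones because every nonzero term
-- of the Leibniz expansion of det B carries the same monomial: each column contributes √w of
-- its end not used as its row.

module Submission where

open import Defs
open import Data.Nat using (ℕ; zero; suc; _∸_; _≤_; _<_; _≤?_; _<?_; z≤n; s≤s)
import Data.Nat.Properties as ℕ
open import Data.Fin using (Fin; zero; suc; punchIn; punchOut; toℕ; _≟_; lift)
open import Data.Fin.Properties
  using ( punchIn-punchOut; punchInᵢ≢i; punchIn-injective; punchOut-injective; suc-injective; 0≢1+n
        ; injective⇒≤; any?)
open import Data.Bool using (Bool; true; false; not; if_then_else_; _∧_)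
open import Data.Product using (∃; ∃₂; _×_; _,_; proj₁; proj₂)
open import Data.Sum using (_⊎_; inj₁; inj₂; [_,_]′; swap)
open import Data.Unit using (⊤)
open import Data.Empty using (⊥; ⊥-elim)
open import Function using (_∘_; Injective)
open import Relation.Nullary using (¬_; yes; no)
open import Relation.Nullary.Decidable using (⌊_⌋)
open import Relation.Binary.PropositionalEquality as ≡ using (_≡_; _≢_; _≗_)
open import Data.Vec.Functional using (removeAt; insertAt; updateAt)
open import Data.Vec.Functional.Properties using (insertAt-lookup; insertAt-punchIn; updateAt-updates; updateAt-minimal)
open import Algebra.Bundles using (CommutativeMonoid; CommutativeRing)
open import Algebra.Morphism.Structures using (IsRingHomomorphism)

module Determinant {c ℓ} (R : CommutativeRing c ℓ) where
  open CommutativeRing R hiding (zero)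
  open RingDefs R using (altSum; det)
  open import Algebra.Properties.Ring ring
    using ( -‿involutive; -0#≈0#; -‿+-comm; -‿anti-homo-+; -‿distribˡ-*; -‿distribʳ-*
          ; +-inverseʳ-unique; xyx⁻¹≈y)
  open import Algebra.Properties.Semiring.Sum semiring
    using (sum; sum-cong-≋; sum-replicate-zero; *-distribʳ-sum)
  open import Algebra.Solver.Ring.NaturalCoefficients.Default commutativeSemiring
    using (solve; _:+_; _:*_; _:=_)
  open import Relation.Binary.Reasoning.Setoid setoid

  x≈0⇒x*y≈0 : ∀ {x} y → x ≈ 0# → x * y ≈ 0#
  x≈0⇒x*y≈0 y x≈0 = trans (*-congʳ x≈0) (zeroˡ y)

  y≈0⇒x*y≈0 : ∀ x {y} → y ≈ 0# → x * y ≈ 0#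
  y≈0⇒x*y≈0 x y≈0 = trans (*-congˡ y≈0) (zeroʳ x)

  neg-square : ∀ x → - x * - x ≈ x * x
  neg-square x = begin
    - x * - x    ≈⟨ sym (-‿distribˡ-* x (- x)) ⟩
    - (x * - x)  ≈⟨ -‿cong (sym (-‿distribʳ-* x x)) ⟩
    - - (x * x)  ≈⟨ -‿involutive (x * x) ⟩
    x * x        ∎

  Matrix : ℕ → Set c
  Matrix k = Fin k → Fin k → Carrier

  minor : ∀ {k} → Matrix (suc k) → Fin (suc k) → Fin (suc k) → Matrix k
  minor M i j x y = M (punchIn i x) (punchIn j y)

  altSum-cong : ∀ {k} {f g : Fin k → Carrier} → (∀ j → f j ≈ g j) → altSum f ≈ altSum g
  altSum-cong {zero}  f≈g = refl
  altSum-cong {suc k} f≈g = +-cong (f≈g zero) (-‿cong (altSum-cong (f≈g ∘ suc)))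

  altSum-zero : ∀ {k} {f : Fin k → Carrier} → (∀ j → f j ≈ 0#) → altSum f ≈ 0#
  altSum-zero {zero}  f≈0 = refl
  altSum-zero {suc k} f≈0 =
    trans (+-cong (f≈0 zero) (-‿cong (altSum-zero (f≈0 ∘ suc)))) (-‿inverseʳ 0#)

  altSum-distrib-+ : ∀ {k} (f g : Fin k → Carrier) →
                     altSum (λ j → f j + g j) ≈ altSum f + altSum g
  altSum-distrib-+ {zero}  f g = sym (+-identityˡ 0#)
  altSum-distrib-+ {suc k} f g = begin
    (f zero + g zero) - altSum (λ j → f (suc j) + g (suc j))
      ≈⟨ +-congˡ (-‿cong (altSum-distrib-+ (f ∘ suc) (g ∘ suc))) ⟩
    (f zero + g zero) - (A + B)
      ≈⟨ +-congˡ (sym (-‿+-comm A B)) ⟩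
    (f zero + g zero) + (- A + - B)
      ≈⟨ solve 4 (λ a b x y → (a :+ b) :+ (x :+ y) := (a :+ x) :+ (b :+ y)) refl
               (f zero) (g zero) (- A) (- B) ⟩
    (f zero - A) + (g zero - B) ∎
    where
    A = altSum (f ∘ suc)
    B = altSum (g ∘ suc)

  altSum-neg : ∀ {k} (f : Fin k → Carrier) → altSum (λ j → - f j) ≈ - altSum f
  altSum-neg {zero}  f = sym -0#≈0#
  altSum-neg {suc k} f =
    trans (+-congˡ (-‿cong (altSum-neg (f ∘ suc)))) (-‿+-comm (f zero) (- altSum (f ∘ suc)))

  *-distribˡ-altSum : ∀ {k} x (f : Fin k → Carrier) → x * altSum f ≈ altSum (λ j → x * f j)
  *-distribˡ-altSum {zero}  x f = zeroʳ x
  *-distribˡ-altSum {suc k} x f = begin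
    x * (f zero - altSum (f ∘ suc))            ≈⟨ distribˡ x (f zero) _ ⟩
    x * f zero + x * - altSum (f ∘ suc)        ≈⟨ +-congˡ (sym (-‿distribʳ-* x _)) ⟩
    x * f zero - x * altSum (f ∘ suc)          ≈⟨ +-congˡ (-‿cong (*-distribˡ-altSum x (f ∘ suc))) ⟩
    x * f zero - altSum (λ j → x * f (suc j))  ∎

  *-distribʳ-altSum : ∀ {k} x (f : Fin k → Carrier) → altSum f * x ≈ altSum (λ j → f j * x)
  *-distribʳ-altSum x f =
    trans (*-comm (altSum f) x) (trans (*-distribˡ-altSum x f) (altSum-cong λ j → *-comm x (f j)))

  altSum-sum : ∀ {k l} (f : Fin l → Fin k → Carrier) →
               altSum (λ j → sum (λ i → f i j)) ≈ sum (λ i → altSum (f i))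
  altSum-sum {k} {zero}  f = altSum-zero {k} λ _ → refl
  altSum-sum {k} {suc l} f = trans (altSum-distrib-+ (f zero) _) (+-congˡ (altSum-sum (f ∘ suc)))

  signed : ℕ → Carrier → Carrier
  signed zero    x = x
  signed (suc n) x = - signed n x

  signed-cong : ∀ n {x y} → x ≈ y → signed n x ≈ signed n y
  signed-cong zero    x≈y = x≈y
  signed-cong (suc n) x≈y = -‿cong (signed-cong n x≈y)

  signed-neg : ∀ n x → signed n (- x) ≈ - signed n x
  signed-neg zero    x = refl
  signed-neg (suc n) x = -‿cong (signed-neg n x)

  signed-involutive : ∀ n x → signed n (signed n x) ≈ x
  signed-involutive zero    x = refl
  signed-involutive (suc n) x = begin
    - signed n (- signed n x)  ≈⟨ -‿cong (signed-neg n _) ⟩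
    - - signed n (signed n x)  ≈⟨ -‿involutive _ ⟩
    signed n (signed n x)      ≈⟨ signed-involutive n x ⟩
    x                          ∎

  signed-zero : ∀ n → signed n 0# ≈ 0#
  signed-zero zero    = refl
  signed-zero (suc n) = trans (-‿cong (signed-zero n)) -0#≈0#

  ≈0⇒signed≈0 : ∀ n {x} → x ≈ 0# → signed n x ≈ 0#
  ≈0⇒signed≈0 n x≈0 = trans (signed-cong n x≈0) (signed-zero n)

  signed≈0⇒≈0 : ∀ n {x} → signed n x ≈ 0# → x ≈ 0#
  signed≈0⇒≈0 n {x} eq = trans (sym (signed-involutive n x)) (≈0⇒signed≈0 n eq)

  *-signed : ∀ n x y → x * signed n y ≈ signed n (x * y)
  *-signed zero    x y = refl
  *-signed (suc n) x y = trans (sym (-‿distribʳ-* x _)) (-‿cong (*-signed n x y))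

  signed-square : ∀ n x → signed n x * signed n x ≈ x * x
  signed-square zero    x = refl
  signed-square (suc n) x = trans (neg-square (signed n x)) (signed-square n x)

  altSum-signed : ∀ {k} n (f : Fin k → Carrier) → altSum (λ j → signed n (f j)) ≈ signed n (altSum f)
  altSum-signed zero    f = refl
  altSum-signed (suc n) f = trans (altSum-neg (λ j → signed n (f j))) (-‿cong (altSum-signed n f))

  altSum-single : ∀ {k} (f : Fin k → Carrier) j₀ → (∀ j → j ≢ j₀ → f j ≈ 0#) →
                  altSum f ≈ signed (toℕ j₀) (f j₀)
  altSum-single f zero others≈0 = begin
    f zero - altSum (f ∘ suc)  ≈⟨ +-congˡ (-‿cong (altSum-zero λ j → others≈0 (suc j) λ ())) ⟩
    f zero - 0#                ≈⟨ +-congˡ -0#≈0# ⟩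
    f zero + 0#                ≈⟨ +-identityʳ _ ⟩
    f zero                     ∎
  altSum-single f (suc j₀) others≈0 = begin
    f zero - altSum (f ∘ suc)          ≈⟨ +-cong (others≈0 zero λ ()) (-‿cong (altSum-single (f ∘ suc) j₀
                                            λ j j≢j₀ → others≈0 (suc j) (j≢j₀ ∘ suc-injective))) ⟩
    0# - signed (toℕ j₀) (f (suc j₀))  ≈⟨ +-identityˡ _ ⟩
    - signed (toℕ j₀) (f (suc j₀))     ∎

  det-cong : ∀ k {M N : Matrix k} → (∀ i j → M i j ≈ N i j) → det k M ≈ det k N
  det-cong zero    M≈N = refl
  det-cong (suc k) M≈N =
    altSum-cong λ j → *-cong (M≈N zero j) (det-cong k λ x y → M≈N (suc x) (punchIn j y))

  pairSum : ∀ m → Matrix (suc (suc m)) → ((Fin m → Fin (suc (suc m))) → Carrier) → Carrier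
  pairSum m F D = altSum λ j → altSum λ j′ → F j (punchIn j j′) * D (punchIn j ∘ punchIn j′)

  pairSum-cong : ∀ m {F G : Matrix (suc (suc m))} {D} → (∀ a b → F a b ≈ G a b) →
                 pairSum m F D ≈ pairSum m G D
  pairSum-cong m {F} {G} {D} F≈G = altSum-cong λ j →
    altSum-cong {g = λ j′ → G j (punchIn j j′) * D (punchIn j ∘ punchIn j′)} λ j′ →
      *-congʳ (F≈G j (punchIn j j′))

  pairSum-+ : ∀ m F G D → pairSum m F D + pairSum m G D ≈ pairSum m (λ a b → F a b + G a b) D
  pairSum-+ m F G D = sym (begin
    (altSum λ j → altSum λ j′ → (F j (punchIn j j′) + G j (punchIn j j′)) * D (punchIn j ∘ punchIn j′))
      ≈⟨ altSum-cong (λ j → altSum-cong λ j′ →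
           distribʳ (D (punchIn j ∘ punchIn j′)) (F j (punchIn j j′)) (G j (punchIn j j′))) ⟩
    (altSum λ j → altSum λ j′ → term F j j′ + term G j j′)
      ≈⟨ altSum-cong (λ j → altSum-distrib-+ (term F j) (term G j)) ⟩
    (altSum λ j → altSum (term F j) + altSum (term G j))
      ≈⟨ altSum-distrib-+ (λ j → altSum (term F j)) (λ j → altSum (term G j)) ⟩
    pairSum m F D + pairSum m G D ∎)
    where
    term : Matrix (suc (suc m)) → Fin (suc (suc m)) → Fin (suc m) → Carrier
    term H j j′ = H j (punchIn j j′) * D (punchIn j ∘ punchIn j′)

  -- Splitting off the index 0 in both sums: the terms (0, b) and (b, 0) cancel by symmetry,
  -- leaving the pairs of nonzero indices.
  pairSum-peel : ∀ m (F : Matrix (suc (suc m))) D → (∀ a b → F a b ≈ F b a) →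
                 pairSum m F D ≈ altSum λ i → altSum λ i′ →
                 F (suc i) (suc (punchIn i i′)) * D (punchIn (suc i) ∘ punchIn (suc i′))
  pairSum-peel m F D F-sym = begin
    X - altSum (λ i → Y i - Z i)           ≈⟨ +-congˡ (-‿cong (altSum-distrib-+ Y (λ i → - Z i))) ⟩
    X - (altSum Y + altSum (λ i → - Z i))  ≈⟨ +-congˡ (-‿cong (+-cong (sym X≈ΣY) (altSum-neg Z))) ⟩
    X - (X - altSum Z)                     ≈⟨ x-[x-y]≈y X (altSum Z) ⟩
    altSum Z                               ∎
    where
    X = altSum λ i → F zero (suc i) * D (suc ∘ punchIn i)
    Y = λ i → F (suc i) zero * D (suc ∘ punchIn i)
    Z = λ i → altSum λ i′ → F (suc i) (suc (punchIn i i′)) * D (punchIn (suc i) ∘ punchIn (suc i′))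
    X≈ΣY : X ≈ altSum Y
    X≈ΣY = altSum-cong {g = Y} λ i → *-congʳ (F-sym zero (suc i))
    x-[x-y]≈y : ∀ x y → x - (x - y) ≈ y
    x-[x-y]≈y x y = begin
      x - (x - y)      ≈⟨ +-congˡ (-‿anti-homo-+ x (- y)) ⟩
      x + (- - y - x)  ≈⟨ +-congˡ (+-congʳ (-‿involutive y)) ⟩
      x + (y - x)      ≈⟨ sym (+-assoc x y (- x)) ⟩
      x + y - x        ≈⟨ xyx⁻¹≈y x y ⟩
      y                ∎

  pairSum-symmetric : ∀ m (F : Matrix (suc (suc m))) D → (∀ a b → F a b ≈ F b a) →
                      (∀ {g h} → g ≗ h → D g ≈ D h) → pairSum m F D ≈ 0#
  pairSum-symmetric zero    F D F-sym D-resp =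
    trans (pairSum-peel zero F D F-sym) (altSum-zero {1} λ _ → refl)
  pairSum-symmetric (suc m) F D F-sym D-resp = begin
    pairSum (suc m) F D
      ≈⟨ pairSum-peel (suc m) F D F-sym ⟩
    (altSum λ i → altSum λ i′ → F (suc i) (suc (punchIn i i′)) * D (punchIn (suc i) ∘ punchIn (suc i′)))
      ≈⟨ altSum-cong (λ i → altSum-cong
           {g = λ i′ → F (suc i) (suc (punchIn i i′)) * D (lift 1 (punchIn i ∘ punchIn i′))}
           λ i′ → *-congˡ (D-resp (lift-punchIn i i′))) ⟩
    pairSum m (λ a b → F (suc a) (suc b)) (D ∘ lift 1)
      ≈⟨ pairSum-symmetric m _ (D ∘ lift 1) (λ a b → F-sym (suc a) (suc b)) (D-resp ∘ lift-cong) ⟩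
    0# ∎
    where
    lift-punchIn : ∀ i i′ → punchIn (suc i) ∘ punchIn (suc i′) ≗ lift 1 (punchIn i ∘ punchIn i′)
    lift-punchIn i i′ zero    = ≡.refl
    lift-punchIn i i′ (suc x) = ≡.refl
    lift-cong : ∀ {g h : Fin m → Fin (suc (suc m))} → g ≗ h → lift 1 g ≗ lift 1 h
    lift-cong g≗h zero    = ≡.refl
    lift-cong g≗h (suc x) = ≡.cong suc (g≗h x)

  lowerRows : ∀ {m} → Matrix (suc (suc m)) → (Fin m → Fin (suc (suc m))) → Carrier
  lowerRows {m} M g = det m λ x y → M (suc (suc x)) (g y)

  lowerRows-cong : ∀ {m} (M : Matrix (suc (suc m))) {g h} → g ≗ h → lowerRows M g ≈ lowerRows M h
  lowerRows-cong {m} M g≗h = det-cong m λ x y → reflexive (≡.cong (M (suc (suc x))) (g≗h y))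

  det-expand₂ : ∀ m (M : Matrix (suc (suc m))) →
                det (suc (suc m)) M ≈ pairSum m (λ a b → M zero a * M (suc zero) b) (lowerRows M)
  det-expand₂ m M = altSum-cong λ j → trans
    (*-distribˡ-altSum (M zero j) λ j′ → M (suc zero) (punchIn j j′) * lowerRows M (punchIn j ∘ punchIn j′))
    (altSum-cong λ j′ → sym (*-assoc (M zero j) (M (suc zero) (punchIn j j′))
                                     (lowerRows M (punchIn j ∘ punchIn j′))))

  det-equalRows₀₁ : ∀ m (M : Matrix (suc (suc m))) → (∀ j → M zero j ≈ M (suc zero) j) →
                    det (suc (suc m)) M ≈ 0#
  det-equalRows₀₁ m M row₀≈row₁ = begin
    det (suc (suc m)) M
      ≈⟨ det-expand₂ m M ⟩
    pairSum m (λ a b → M zero a * M (suc zero) b) (lowerRows M)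
      ≈⟨ pairSum-cong m {D = lowerRows M} (λ a b → *-congˡ {M zero a} (sym (row₀≈row₁ b))) ⟩
    pairSum m (λ a b → M zero a * M zero b) (lowerRows M)
      ≈⟨ pairSum-symmetric m (λ a b → M zero a * M zero b) _ (λ a b → *-comm _ _) (lowerRows-cong M) ⟩
    0# ∎

  swapRows₀₁ : ∀ {m} → Matrix (suc (suc m)) → Matrix (suc (suc m))
  swapRows₀₁ M zero          = M (suc zero)
  swapRows₀₁ M (suc zero)    = M zero
  swapRows₀₁ M (suc (suc r)) = M (suc (suc r))

  det-swapRows₀₁ : ∀ m (M : Matrix (suc (suc m))) →
                   det (suc (suc m)) (swapRows₀₁ M) ≈ - det (suc (suc m)) M
  det-swapRows₀₁ m M = +-inverseʳ-unique _ _ (begin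
    det (suc (suc m)) M + det (suc (suc m)) (swapRows₀₁ M)
      ≈⟨ +-cong (det-expand₂ m M) (det-expand₂ m (swapRows₀₁ M)) ⟩
    pairSum m F D + pairSum m Fᵀ D
      ≈⟨ pairSum-+ m F Fᵀ D ⟩
    pairSum m (λ a b → F a b + Fᵀ a b) D
      ≈⟨ pairSum-symmetric m _ D F+Fᵀ-symmetric (lowerRows-cong M) ⟩
    0# ∎)
    where
    F Fᵀ : Matrix (suc (suc m))
    F  a b = M zero a * M (suc zero) b
    Fᵀ a b = M (suc zero) a * M zero b
    D = lowerRows M
    F+Fᵀ-symmetric : ∀ a b → F a b + Fᵀ a b ≈ F b a + Fᵀ b a
    F+Fᵀ-symmetric a b = trans (+-comm _ _) (+-cong (*-comm _ _) (*-comm _ _))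

  moveToTop : ∀ {k} {A : Set c} → Fin (suc k) → (Fin (suc k) → A) → Fin (suc k) → A
  moveToTop i M zero    = M i
  moveToTop i M (suc r) = M (punchIn i r)

  moveToSecond : ∀ {k} {A : Set c} → Fin (suc k) → (Fin (suc (suc k)) → A) → Fin (suc (suc k)) → A
  moveToSecond i M zero    = M zero
  moveToSecond i M (suc r) = moveToTop i (M ∘ suc) r

  det-moveToTop : ∀ k i (M : Matrix (suc k)) →
                  det (suc k) (moveToTop i M) ≈ signed (toℕ i) (det (suc k) M)
  det-moveToSecond : ∀ k i (M : Matrix (suc (suc k))) →
                     det (suc (suc k)) (moveToSecond i M) ≈ signed (toℕ i) (det (suc (suc k)) M)

  det-moveToTop k zero M = det-cong (suc k) {moveToTop zero M} {M} λ where
    zero    j → refl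
    (suc r) j → refl
  det-moveToTop (suc k) (suc i) M = begin
    det (suc (suc k)) (moveToTop (suc i) M)            ≈⟨ det-cong (suc (suc k)) moveToTop≈swap ⟩
    det (suc (suc k)) (swapRows₀₁ (moveToSecond i M))  ≈⟨ det-swapRows₀₁ k (moveToSecond i M) ⟩
    - det (suc (suc k)) (moveToSecond i M)             ≈⟨ -‿cong (det-moveToSecond k i M) ⟩
    - signed (toℕ i) (det (suc (suc k)) M)             ∎
    where
    moveToTop≈swap : ∀ r j → moveToTop (suc i) M r j ≈ swapRows₀₁ (moveToSecond i M) r j
    moveToTop≈swap zero          j = refl
    moveToTop≈swap (suc zero)    j = refl
    moveToTop≈swap (suc (suc r)) j = refl

  det-moveToSecond k i M = begin
    altSum (λ j → M zero j * det (suc k) (minor (moveToSecond i M) zero j))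
      ≈⟨ altSum-cong (λ j → *-congˡ {M zero j} (det-cong (suc k) (minor≈ j))) ⟩
    altSum (λ j → M zero j * det (suc k) (moveToTop i (minor M zero j)))
      ≈⟨ altSum-cong (λ j → *-congˡ {M zero j} (det-moveToTop k i (minor M zero j))) ⟩
    altSum (λ j → M zero j * signed (toℕ i) (det (suc k) (minor M zero j)))
      ≈⟨ altSum-cong (λ j → *-signed (toℕ i) (M zero j) (det (suc k) (minor M zero j))) ⟩
    altSum (λ j → signed (toℕ i) (M zero j * det (suc k) (minor M zero j)))
      ≈⟨ altSum-signed (toℕ i) (λ j → M zero j * det (suc k) (minor M zero j)) ⟩
    signed (toℕ i) (det (suc (suc k)) M) ∎
    where
    minor≈ : ∀ j r y → minor (moveToSecond i M) zero j r y ≈ moveToTop i (minor M zero j) r y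
    minor≈ j zero    y = refl
    minor≈ j (suc r) y = refl

  det-equalRows : ∀ k i (M : Matrix (suc (suc k))) → (∀ j → M zero j ≈ M (suc i) j) →
                  det (suc (suc k)) M ≈ 0#
  det-equalRows k i M row₀≈rowᵢ = signed≈0⇒≈0 (toℕ i)
    (trans (sym (det-moveToSecond k i M)) (det-equalRows₀₁ k (moveToSecond i M) row₀≈rowᵢ))

  det-zeroRow : ∀ k (i : Fin k) (M : Matrix k) → (∀ j → M i j ≈ 0#) → det k M ≈ 0#
  det-zeroRow (suc k) zero    M row≈0 = altSum-zero λ j → x≈0⇒x*y≈0 (det k (minor M zero j)) (row≈0 j)
  det-zeroRow (suc k) (suc i) M row≈0 = altSum-zero λ j →
    y≈0⇒x*y≈0 (M zero j) (det-zeroRow k i (minor M zero j) (row≈0 ∘ punchIn j))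

  det-zeroColumn : ∀ k (j₀ : Fin k) (M : Matrix k) → (∀ i → M i j₀ ≈ 0#) → det k M ≈ 0#
  det-zeroColumn (suc k) j₀ M col≈0 = altSum-zero term≈0
    where
    term≈0 : ∀ j → M zero j * det k (minor M zero j) ≈ 0#
    term≈0 j with j ≟ j₀
    ... | yes ≡.refl = x≈0⇒x*y≈0 _ (col≈0 zero)
    ... | no j≢j₀    = y≈0⇒x*y≈0 _ (det-zeroColumn k (punchOut j≢j₀) (minor M zero j) λ r →
                         trans (reflexive (≡.cong (M (suc r)) (punchIn-punchOut j≢j₀))) (col≈0 (suc r)))

  -- Expanding along row 0 is linear in that row, and expanding another row i with the
  -- cofactors of row 0 gives the determinant of a matrix whose rows 0 and i agree.
  det-columnSums≈0 : ∀ k (M : Matrix (suc k)) → (∀ j → sum (λ i → M i j) ≈ 0#) → det (suc k) M ≈ 0#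
  det-columnSums≈0 k M colSum≈0 = begin
    expandWith (M zero)                     ≈⟨ sym (+-identityʳ _) ⟩
    expandWith (M zero) + 0#                ≈⟨ +-congˡ (sym (sum-zero (otherRow≈0 M))) ⟩
    sum (λ i → expandWith (M i))            ≈⟨ sym (altSum-sum λ i j → M i j * C j) ⟩
    altSum (λ j → sum (λ i → M i j * C j))  ≈⟨ altSum-cong (λ j → sym (*-distribʳ-sum (C j) (M-column j))) ⟩
    altSum (λ j → sum (M-column j) * C j)   ≈⟨ altSum-zero (λ j → x≈0⇒x*y≈0 (C j) (colSum≈0 j)) ⟩
    0#                                      ∎
    where
    M-column : Fin (suc k) → Fin (suc k) → Carrier
    M-column j i = M i j
    C : Fin (suc k) → Carrier
    C j = det k (minor M zero j)
    expandWith : (Fin (suc k) → Carrier) → Carrier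
    expandWith row = altSum λ j → row j * C j
    sum-zero : ∀ {l} {f : Fin l → Carrier} → (∀ i → f i ≈ 0#) → sum f ≈ 0#
    sum-zero {l} f≈0 = trans (sum-cong-≋ f≈0) (sum-replicate-zero l)
    otherRow≈0 : ∀ {k} (N : Matrix (suc k)) i → altSum (λ j → N (suc i) j * det k (minor N zero j)) ≈ 0#
    otherRow≈0 {suc k} N i = det-equalRows k i (λ where zero → N (suc i) ; (suc r) → N (suc r)) λ _ → refl

  det-singleEntryRow : ∀ k (M : Matrix (suc k)) i₀ j₀ → (∀ j → j ≢ j₀ → M i₀ j ≈ 0#) →
                       det (suc k) M ≈ signed (toℕ i₀) (signed (toℕ j₀) (M i₀ j₀ * det k (minor M i₀ j₀)))
  det-singleEntryRow k M i₀ j₀ others≈0 = begin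
    det (suc k) M
      ≈⟨ sym (signed-involutive (toℕ i₀) _) ⟩
    signed (toℕ i₀) (signed (toℕ i₀) (det (suc k) M))
      ≈⟨ signed-cong (toℕ i₀) (sym (det-moveToTop k i₀ M)) ⟩
    signed (toℕ i₀) (det (suc k) (moveToTop i₀ M))
      ≈⟨ signed-cong (toℕ i₀) (altSum-single _ j₀ λ j j≢j₀ →
           x≈0⇒x*y≈0 (det k (minor M i₀ j)) (others≈0 j j≢j₀)) ⟩
    signed (toℕ i₀) (signed (toℕ j₀) (M i₀ j₀ * det k (minor M i₀ j₀))) ∎

  det-singleEntryRow-≈0 : ∀ k (M : Matrix (suc k)) i₀ j₀ → (∀ j → j ≢ j₀ → M i₀ j ≈ 0#) →
                          det k (minor M i₀ j₀) ≈ 0# → det (suc k) M ≈ 0#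
  det-singleEntryRow-≈0 k M i₀ j₀ others≈0 minor≈0 = trans (det-singleEntryRow k M i₀ j₀ others≈0)
    (≈0⇒signed≈0 (toℕ i₀) (≈0⇒signed≈0 (toℕ j₀) (y≈0⇒x*y≈0 (M i₀ j₀) minor≈0)))

  det-singleEntryRow-square : ∀ k (M : Matrix (suc k)) i₀ j₀ → (∀ j → j ≢ j₀ → M i₀ j ≈ 0#) →
                              det (suc k) M * det (suc k) M ≈
                              (M i₀ j₀ * M i₀ j₀) * (det k (minor M i₀ j₀) * det k (minor M i₀ j₀))
  det-singleEntryRow-square k M i₀ j₀ others≈0 = begin
    det (suc k) M * det (suc k) M                  ≈⟨ *-cong expansion expansion ⟩
    signed i (signed j x) * signed i (signed j x)  ≈⟨ trans (signed-square i _) (signed-square j x) ⟩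
    (a * d) * (a * d)                              ≈⟨ solve 2 (λ a d → (a :* d) :* (a :* d) := (a :* a) :* (d :* d))
                                                            refl a d ⟩
    (a * a) * (d * d)                              ∎
    where
    i = toℕ i₀
    j = toℕ j₀
    a = M i₀ j₀
    d = det k (minor M i₀ j₀)
    x = a * d
    expansion = det-singleEntryRow k M i₀ j₀ others≈0

module FinSum {a ℓ} (M : CommutativeMonoid a ℓ) where
  open CommutativeMonoid M
  open import Algebra.Properties.CommutativeMonoid.Sum M
    using (sum; sum-remove; sum-cong-≋; sum-cong-≗; sum-replicate-zero)
  open import Relation.Binary.Reasoning.Setoid setoid

  sum-vanishing-off-image : ∀ {k l} (σ : Fin k → Fin l) → Injective _≡_ _≡_ σ → (f : Fin l → Carrier) →
                            (∀ x → (∀ j → σ j ≢ x) → f x ≈ ε) → sum f ≈ sum (f ∘ σ)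
  sum-vanishing-off-image {zero}  {l}     σ σ-inj f outside≈ε =
    trans (sum-cong-≋ λ x → outside≈ε x λ ()) (sum-replicate-zero l)
  sum-vanishing-off-image {suc k} {zero}  σ σ-inj f outside≈ε with () ← σ zero
  sum-vanishing-off-image {suc k} {suc l} σ σ-inj f outside≈ε = begin
    sum f
      ≈⟨ sum-remove {i = σ zero} f ⟩
    f (σ zero) ∙ sum (removeAt f (σ zero))
      ≈⟨ ∙-congˡ (sum-vanishing-off-image σ′ σ′-inj (removeAt f (σ zero)) outside′≈ε) ⟩
    f (σ zero) ∙ sum (removeAt f (σ zero) ∘ σ′)
      ≡⟨ ≡.cong (f (σ zero) ∙_) (sum-cong-≗ (≡.cong f ∘ punchIn-punchOut ∘ σ₀≢σ)) ⟩
    sum (f ∘ σ) ∎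
    where
    σ₀≢σ : ∀ j → σ zero ≢ σ (suc j)
    σ₀≢σ j = 0≢1+n ∘ σ-inj
    σ′ : Fin k → Fin l
    σ′ j = punchOut (σ₀≢σ j)
    σ′-inj : Injective _≡_ _≡_ σ′
    σ′-inj {i} {j} eq = suc-injective (σ-inj (punchOut-injective (σ₀≢σ i) (σ₀≢σ j) eq))
    outside′≈ε : ∀ x → (∀ j → σ′ j ≢ x) → removeAt f (σ zero) x ≈ ε
    outside′≈ε x notImage = outside≈ε (punchIn (σ zero) x) λ where
      zero    eq → punchInᵢ≢i (σ zero) x (≡.sym eq)
      (suc j) eq → notImage j (punchIn-injective (σ zero) _ _ (≡.trans (punchIn-punchOut (σ₀≢σ j)) eq))

  sum-single : ∀ {l} (f : Fin l → Carrier) y → (∀ x → x ≢ y → f x ≈ ε) → sum f ≈ f y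
  sum-single f y others≈ε = trans
    (sum-vanishing-off-image (λ (_ : Fin 1) → y) (λ { {zero} {zero} _ → ≡.refl }) f
                             λ x notY → others≈ε x (notY zero ∘ ≡.sym))
    (identityʳ (f y))

module NatSum where
  open import Algebra.Properties.CommutativeMonoid.Sum ℕ.+-0-commutativeMonoid public using (sum)

  sum≡0⇒ : ∀ {k} (f : Fin k → ℕ) → sum f ≡ 0 → ∀ j → f j ≡ 0
  sum≡0⇒ f sum≡0 zero    = ℕ.m+n≡0⇒m≡0 (f zero) sum≡0
  sum≡0⇒ f sum≡0 (suc j) = sum≡0⇒ (f ∘ suc) (ℕ.m+n≡0⇒n≡0 (f zero) sum≡0) j

  sum>0⇒ : ∀ {k} (f : Fin k → ℕ) → 0 < sum f → ∃ λ j → 0 < f j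
  sum>0⇒ {suc k} f 0<sum with f zero in eq
  ... | suc _ = zero , ≡.subst (0 <_) (≡.sym eq) (s≤s z≤n)
  ... | zero  = let j , 0<f = sum>0⇒ (f ∘ suc) 0<sum in suc j , 0<f

  sum-mono-≤ : ∀ {k} {f g : Fin k → ℕ} → (∀ j → f j ≤ g j) → sum f ≤ sum g
  sum-mono-≤ {zero}  f≤g = z≤n
  sum-mono-≤ {suc k} f≤g = ℕ.+-mono-≤ (f≤g zero) (sum-mono-≤ (f≤g ∘ suc))

  sum-mono-≤-tight : ∀ {k} {f g : Fin k → ℕ} → (∀ j → f j ≤ g j) → sum g ≤ sum f →
                     ∀ j → f j ≡ g j
  sum-mono-≤-tight {suc k} {f} {g} f≤g Σg≤Σf = tight
    where
    Σf≤Σg : sum (f ∘ suc) ≤ sum (g ∘ suc)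
    Σf≤Σg = sum-mono-≤ (f≤g ∘ suc)
    tight : ∀ j → f j ≡ g j
    tight zero    = ℕ.≤-antisym (f≤g zero) (ℕ.+-cancelʳ-≤ (sum (g ∘ suc)) _ _
                      (ℕ.≤-trans Σg≤Σf (ℕ.+-monoʳ-≤ (f zero) Σf≤Σg)))
    tight (suc j) = sum-mono-≤-tight (f≤g ∘ suc) (ℕ.+-cancelˡ-≤ (g zero) _ _
                      (ℕ.≤-trans Σg≤Σf (ℕ.+-monoˡ-≤ (sum (f ∘ suc)) (f≤g zero)))) j

injective⇒surjective : ∀ {k} (f : Fin k → Fin k) → Injective _≡_ _≡_ f → ∀ j → ∃ λ i → f i ≡ j
injective⇒surjective {suc k} f f-inj j with any? (λ i → f i ≟ j)
... | yes hit  = hit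
... | no  miss = ⊥-elim (ℕ.1+n≰n (injective⇒≤ {f = λ i → punchOut (j≢f i)} λ eq →
                                     f-inj (punchOut-injective (j≢f _) (j≢f _) eq)))
  where
  j≢f : ∀ i → j ≢ f i
  j≢f i j≡fi = miss (i , ≡.sym j≡fi)

argmax : ∀ {k} (f : Fin (suc k) → ℕ) → ∃ λ i₀ → ∀ i → f i ≤ f i₀
argmax {zero}  f = zero , λ { zero → ℕ.≤-refl }
argmax {suc k} f with i₁ , f≤fi₁ ← argmax (f ∘ suc) | f zero ≤? f (suc i₁)
... | yes f₀≤ = suc i₁ , λ { zero → f₀≤ ; (suc i) → f≤fi₁ i }
... | no  f₀≰ = zero , λ where
  zero    → ℕ.≤-refl
  (suc i) → ℕ.≤-trans (f≤fi₁ i) (ℕ.<⇒≤ (ℕ.≰⇒> f₀≰))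

≡-or-punchIn : ∀ {k} (i j : Fin (suc k)) → j ≡ i ⊎ ∃ λ j′ → punchIn i j′ ≡ j
≡-or-punchIn i j with i ≟ j
... | yes i≡j = inj₁ (≡.sym i≡j)
... | no  i≢j = inj₂ (punchOut i≢j , punchIn-punchOut i≢j)

insertAt-injective : ∀ {a} {A : Set a} {k} {xs : Fin k → A} → Injective _≡_ _≡_ xs →
                     ∀ i {y} → (∀ j → xs j ≢ y) → Injective _≡_ _≡_ (insertAt xs i y)
insertAt-injective {xs = xs} xs-inj i {y} y∉xs {j} {j′} eq with ≡-or-punchIn i j | ≡-or-punchIn i j′
... | inj₁ ≡.refl       | inj₁ ≡.refl        = ≡.refl
... | inj₁ ≡.refl       | inj₂ (l′ , ≡.refl) = ⊥-elim (y∉xs l′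
  (≡.trans (≡.sym (insertAt-punchIn xs i y l′)) (≡.trans (≡.sym eq) (insertAt-lookup xs i y))))
... | inj₂ (l , ≡.refl) | inj₁ ≡.refl        = ⊥-elim (y∉xs l
  (≡.trans (≡.sym (insertAt-punchIn xs i y l)) (≡.trans eq (insertAt-lookup xs i y))))
... | inj₂ (l , ≡.refl) | inj₂ (l′ , ≡.refl) = ≡.cong (punchIn i) (xs-inj
  (≡.trans (≡.sym (insertAt-punchIn xs i y l)) (≡.trans eq (insertAt-punchIn xs i y l′))))

module Edges {n m : ℕ} (X : Graph n m) where
  open import Data.Nat using (_+_)
  open Graph X

  Joins : Fin m → Fin n → Fin n → Set
  Joins e x y = (o e ≡ x × t e ≡ y) ⊎ (o e ≡ y × t e ≡ x)

  NotIncident : Fin m → Fin n → Set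
  NotIncident e x = o e ≢ x × t e ≢ x

  joins-notIncident : ∀ {e x u w} → NotIncident e x → Joins e u w → u ≢ x × w ≢ x
  joins-notIncident (o≢x , t≢x) (inj₁ (≡.refl , ≡.refl)) = o≢x , t≢x
  joins-notIncident (o≢x , t≢x) (inj₂ (≡.refl , ≡.refl)) = t≢x , o≢x

  joins⇒notIncident : ∀ {e x u w} → Joins e u w → u ≢ x → w ≢ x → NotIncident e x
  joins⇒notIncident (inj₁ (≡.refl , ≡.refl)) u≢x w≢x = u≢x , w≢x
  joins⇒notIncident (inj₂ (≡.refl , ≡.refl)) u≢x w≢x = w≢x , u≢x

  t-bar : ∀ e → t (bar e) ≡ o e
  t-bar e = ≡.trans (≡.sym (o-bar (bar e))) (≡.cong o (bar-inv e))

  bar-injective : ∀ {e e′} → bar e ≡ bar e′ → e ≡ e′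
  bar-injective {e} {e′} eq = ≡.trans (≡.sym (bar-inv e)) (≡.trans (≡.cong bar eq) (bar-inv e′))

  Orientation : Fin m → Fin m → Set
  Orientation b e = b ≡ e ⊎ b ≡ bar e

  orientation⇒joins : ∀ {b e} → Orientation b e → Joins b (o e) (t e)
  orientation⇒joins (inj₁ ≡.refl) = inj₁ (≡.refl , ≡.refl)
  orientation⇒joins (inj₂ ≡.refl) = inj₂ (o-bar _ , t-bar _)

  orientations : ∀ {b e e′} → Orientation b e → Orientation b e′ → e ≡ e′ ⊎ e ≡ bar e′
  orientations (inj₁ ≡.refl) (inj₁ ≡.refl) = inj₁ ≡.refl
  orientations (inj₁ ≡.refl) (inj₂ ≡.refl) = inj₂ ≡.refl
  orientations (inj₂ ≡.refl) (inj₁ b≡e′)   = inj₂ (≡.trans (≡.sym (bar-inv _)) (≡.cong bar b≡e′))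
  orientations (inj₂ ≡.refl) (inj₂ b≡e′)   = inj₁ (bar-injective b≡e′)

  joins-descending : ∀ (h : Fin n → ℕ) {e x y x′ y′} → Joins e x y → Joins e x′ y′ →
                     h y < h x → h y′ ≤ h x′ → x ≡ x′ × y ≡ y′
  joins-descending h (inj₁ (≡.refl , ≡.refl)) (inj₁ (≡.refl , ≡.refl)) _ _ = ≡.refl , ≡.refl
  joins-descending h (inj₂ (≡.refl , ≡.refl)) (inj₂ (≡.refl , ≡.refl)) _ _ = ≡.refl , ≡.refl
  joins-descending h (inj₁ (≡.refl , ≡.refl)) (inj₂ (≡.refl , ≡.refl)) y<x = ⊥-elim ∘ ℕ.<⇒≱ y<x
  joins-descending h (inj₂ (≡.refl , ≡.refl)) (inj₁ (≡.refl , ≡.refl)) y<x = ⊥-elim ∘ ℕ.<⇒≱ y<x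

  Tilde-elim : ∀ {k} (a : Fin k → Fin m) {e} → Tilde X a e → ∃ λ j → Orientation (a j) e
  Tilde-elim {suc k} a {e} e∈ with a zero ≟ e | a zero ≟ bar e
  ... | yes a₀≡e | _        = zero , inj₁ a₀≡e
  ... | no _     | yes a₀≡ē = zero , inj₂ a₀≡ē
  ... | no _     | no _     = let j , orient = Tilde-elim (a ∘ suc) e∈ in suc j , orient

  Tilde-intro : ∀ {k} (a : Fin k → Fin m) {e} j → Orientation (a j) e → Tilde X a e
  Tilde-intro a {e} zero orient with a zero ≟ e | a zero ≟ bar e
  ... | yes _   | _       = _
  ... | no _    | yes _   = _
  ... | no a₀≢e | no a₀≢ē = ⊥-elim ([ a₀≢e , a₀≢ē ]′ orient)
  Tilde-intro a {e} (suc j) orient with a zero ≟ e | a zero ≟ bar e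
  ... | yes _   | _       = _
  ... | no _    | yes _   = _
  ... | no _    | no _    = Tilde-intro (a ∘ suc) j orient

  Tilde-bar : ∀ {k} (a : Fin k → Fin m) e → Tilde X a e → Tilde X a (bar e)
  Tilde-bar a e e∈ with j , orient ← Tilde-elim a e∈ = Tilde-intro a j (bar-orientation orient)
    where
    bar-orientation : ∀ {b} → Orientation b e → Orientation b (bar e)
    bar-orientation (inj₁ b≡e) = inj₂ (≡.trans b≡e (≡.sym (bar-inv e)))
    bar-orientation (inj₂ b≡ē) = inj₁ b≡ē

  module _ {P : Fin m → Set} where

    snoc : ∀ {u x k} → Walk X P u x k → ∀ e → P e → o e ≡ x → Walk X P u (t e) (suc k)
    snoc nil           e pe ≡.refl = cons e pe nil
    snoc (cons e′ pe′ W) e pe oe≡x = cons e′ pe′ (snoc W e pe oe≡x)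

    reverse : (∀ e → P e → P (bar e)) → ∀ {u x k} → Walk X P u x k → Walk X P x u k
    reverse P-bar nil           = nil
    reverse P-bar (cons e pe W) =
      ≡.subst (λ y → Walk X P _ y _) (t-bar e) (snoc (reverse P-bar W) (bar e) (P-bar e pe) (o-bar e))

    _++_ : ∀ {u x y k l} → Walk X P u x k → Walk X P x y l → Walk X P u y (k + l)
    nil         ++ W′ = W′
    cons e pe W ++ W′ = cons e pe (W ++ W′)

    firstEdge : ∀ {x y k} → Walk X P x y k → x ≢ y →
                ∃ λ e → P e × o e ≡ x × ∃ λ k′ → k ≡ suc k′ × Walk X P (t e) y k′
    firstEdge nil           x≢x = ⊥-elim (x≢x ≡.refl)
    firstEdge (cons e pe W) _   = e , pe , ≡.refl , _ , ≡.refl , W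

module Degrees {n m : ℕ} (X : Graph n m) where
  open import Data.Nat using (_+_)
  open Graph X
  open Edges X using (Joins; NotIncident)
  open NatSum
  open import Algebra.Properties.CommutativeMonoid.Sum ℕ.+-0-commutativeMonoid
    using (sum-remove; sum-cong-≗; sum-replicate-zero; ∑-comm; ∑-distrib-+)

  δ : Fin n → Fin n → ℕ
  δ x y with x ≟ y
  ... | yes _ = 1
  ... | no  _ = 0

  δ-refl : ∀ x → δ x x ≡ 1
  δ-refl x with x ≟ x
  ... | yes _   = ≡.refl
  ... | no  x≢x = ⊥-elim (x≢x ≡.refl)

  δ-≢ : ∀ {x y} → x ≢ y → δ x y ≡ 0
  δ-≢ {x} {y} x≢y with x ≟ y
  ... | yes x≡y = ⊥-elim (x≢y x≡y)
  ... | no  _   = ≡.refl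

  δ-sym : ∀ x y → δ x y ≡ δ y x
  δ-sym x y with x ≟ y | y ≟ x
  ... | yes _   | yes _   = ≡.refl
  ... | yes x≡y | no  y≢x = ⊥-elim (y≢x (≡.sym x≡y))
  ... | no  x≢y | yes y≡x = ⊥-elim (x≢y (≡.sym y≡x))
  ... | no  _   | no  _   = ≡.refl

  δ≡0⇒≢ : ∀ {x y} → δ x y ≡ 0 → x ≢ y
  δ≡0⇒≢ {x} {y} δ≡0 with x ≟ y
  δ≡0⇒≢ () | yes _
  ... | no x≢y = x≢y

  δ>0⇒≡ : ∀ {x y} → 0 < δ x y → x ≡ y
  δ>0⇒≡ {x} {y} 0<δ with x ≟ y
  δ>0⇒≡ _  | yes x≡y = x≡y
  δ>0⇒≡ () | no _

  incidence : Fin m → Fin n → ℕ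
  incidence e x = δ (o e) x + δ (t e) x

  degree : ∀ {k} → (Fin k → Fin m) → Fin n → ℕ
  degree a x = sum λ j → incidence (a j) x

  rowCount : ∀ {k} → (Fin k → Fin n) → Fin n → ℕ
  rowCount r x = sum λ i → δ (r i) x

  incidence≡0⇒ : ∀ {e x} → incidence e x ≡ 0 → NotIncident e x
  incidence≡0⇒ {e} inc≡0 =
    δ≡0⇒≢ (ℕ.m+n≡0⇒m≡0 _ inc≡0) , δ≡0⇒≢ (ℕ.m+n≡0⇒n≡0 (δ (o e) _) inc≡0)

  incidence≡1⇒ : ∀ {e x} → incidence e x ≡ 1 → ∃ λ y → Joins e x y × y ≢ x
  incidence≡1⇒ {e} {x} inc≡1 with o e ≟ x
  ... | yes o≡x = t e , inj₁ (o≡x , ≡.refl) , δ≡0⇒≢ (ℕ.suc-injective inc≡1)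
  ... | no  o≢x = o e , inj₂ (≡.refl , δ>0⇒≡ (≡.subst (0 <_) (≡.sym inc≡1) (s≤s z≤n))) , o≢x

  degree≡0⇒ : ∀ {k} (a : Fin k → Fin m) x → degree a x ≡ 0 → ∀ j → NotIncident (a j) x
  degree≡0⇒ a x deg≡0 j = incidence≡0⇒ (sum≡0⇒ _ deg≡0 j)

  degree≡1⇒leaf : ∀ {k} (a : Fin (suc k) → Fin m) x → degree a x ≡ 1 →
                  ∃₂ λ j₀ y → Joins (a j₀) x y × y ≢ x × ∀ j′ → NotIncident (a (punchIn j₀ j′)) x
  degree≡1⇒leaf a x deg≡1
    with j₀ , 0<inc ← sum>0⇒ (λ j → incidence (a j) x) (≡.subst (0 <_) (≡.sym deg≡1) (s≤s z≤n))
    with incidence (a j₀) x | sum-remove {i = j₀} (λ j → incidence (a j) x) | incidence≡1⇒ {a j₀} {x}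
  ... | suc zero    | deg≡1+rest | leafEdge =
    let y , joins , y≢x = leafEdge ≡.refl
    in j₀ , y , joins , y≢x ,
       degree≡0⇒ (a ∘ punchIn j₀) x (ℕ.suc-injective (≡.trans (≡.sym deg≡1+rest) deg≡1))
  ... | suc (suc _) | deg≡2+rest | _ with () ← ≡.trans (≡.sym deg≡1) deg≡2+rest

  rowCount≤1 : ∀ {k} (r : Fin k → Fin n) → Injective _≡_ _≡_ r → ∀ x → rowCount r x ≤ 1
  rowCount≤1 {zero}  r r-inj x = z≤n
  rowCount≤1 {suc k} r r-inj x with r zero ≟ x
  ... | no  _      = rowCount≤1 (r ∘ suc) (suc-injective ∘ r-inj) x
  ... | yes r₀≡x = s≤s (ℕ.≤-reflexive (≡.trans
    (sum-cong-≗ {k} {x = λ i → δ (r (suc i)) x} λ i → δ-≢ λ rᵢ≡x →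
       0≢1+n (r-inj (≡.trans r₀≡x (≡.sym rᵢ≡x))))
    (sum-replicate-zero k)))

  rowCount>0⇒ : ∀ {k} (r : Fin k → Fin n) x → 0 < rowCount r x → ∃ λ i → r i ≡ x
  rowCount>0⇒ r x 0<count = let i , 0<δ = sum>0⇒ _ 0<count in i , δ>0⇒≡ 0<δ

  incidence-joins : ∀ {e u y} → Joins e u y → ∀ x → incidence e x ≡ δ u x + δ y x
  incidence-joins (inj₁ (≡.refl , ≡.refl)) x = ≡.refl
  incidence-joins {e} (inj₂ (≡.refl , ≡.refl)) x = ℕ.+-comm (δ (o e) x) (δ (t e) x)

  exponent : ∀ {k} → (Fin k → Fin n) → (Fin k → Fin m) → Fin n → ℕ
  exponent r a x = degree a x ∸ rowCount r x

  exponent-removeColumn : ∀ {k} (r : Fin (suc k) → Fin n) (a : Fin (suc k) → Fin m) j {y} →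
                          Joins (a j) (r zero) y → rowCount (r ∘ suc) y ≤ degree (a ∘ punchIn j) y →
                          ∀ x → exponent r a x ≡ δ y x + exponent (r ∘ suc) (a ∘ punchIn j) x
  exponent-removeColumn r a j {y} joinsʲ rows≤deg x = begin
    degree a x ∸ rowCount r x
      ≡⟨ ≡.cong (_∸ rowCount r x) (sum-remove {i = j} λ j′ → incidence (a j′) x) ⟩
    (incidence (a j) x + degree a′ x) ∸ (δ (r zero) x + rowCount r′ x)
      ≡⟨ ≡.cong (λ i → (i + degree a′ x) ∸ rowCount r x) (incidence-joins joinsʲ x) ⟩
    (δ (r zero) x + δ y x + degree a′ x) ∸ (δ (r zero) x + rowCount r′ x)
      ≡⟨ ≡.cong (_∸ rowCount r x) (ℕ.+-assoc (δ (r zero) x) (δ y x) (degree a′ x)) ⟩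
    (δ (r zero) x + (δ y x + degree a′ x)) ∸ (δ (r zero) x + rowCount r′ x)
      ≡⟨ ℕ.[m+n]∸[m+o]≡n∸o (δ (r zero) x) _ _ ⟩
    (δ y x + degree a′ x) ∸ rowCount r′ x
      ≡⟨ ∸-δ ⟩
    δ y x + (degree a′ x ∸ rowCount r′ x) ∎
    where
    open ≡.≡-Reasoning
    a′ = a ∘ punchIn j
    r′ = r ∘ suc
    ∸-δ : (δ y x + degree a′ x) ∸ rowCount r′ x ≡ δ y x + (degree a′ x ∸ rowCount r′ x)
    ∸-δ with y ≟ x
    ... | yes ≡.refl = ℕ.+-∸-assoc 1 rows≤deg
    ... | no  _      = ≡.refl

  -- Double counting: the row vertices have total degree at least 2k, and each of the
  -- k columns contributes at most 2 to it.
  coreColumns : ∀ {k} (r : Fin k → Fin n) (a : Fin k → Fin m) → Injective _≡_ _≡_ r →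
                (∀ i → 2 ≤ degree a (r i)) →
                ∀ j → (∃ λ i → r i ≡ o (a j)) × (∃ λ i → r i ≡ t (a j))
  coreColumns {k} r a r-inj 2≤deg j
    with both-1 (rowCount≤1 r r-inj _) (rowCount≤1 r r-inj _) (sum-mono-≤-tight endpointRows≤2 total j)
    where
    endpointRows : Fin k → ℕ
    endpointRows j = rowCount r (o (a j)) + rowCount r (t (a j))
    endpointRows≤2 : ∀ j → endpointRows j ≤ 2
    endpointRows≤2 j = ℕ.+-mono-≤ (rowCount≤1 r r-inj _) (rowCount≤1 r r-inj _)
    double-count : sum (λ i → degree a (r i)) ≡ sum endpointRows
    double-count = begin
      sum (λ i → sum λ j → δ (o (a j)) (r i) + δ (t (a j)) (r i))
        ≡⟨ ∑-comm (λ i j → δ (o (a j)) (r i) + δ (t (a j)) (r i)) ⟩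
      sum (λ j → sum λ i → δ (o (a j)) (r i) + δ (t (a j)) (r i))
        ≡⟨ sum-cong-≗ (λ j → ∑-distrib-+ (λ i → δ (o (a j)) (r i)) _) ⟩
      sum (λ j → sum (λ i → δ (o (a j)) (r i)) + sum (λ i → δ (t (a j)) (r i)))
        ≡⟨ sum-cong-≗ (λ j → ≡.cong₂ _+_ (sum-cong-≗ λ i → δ-sym (o (a j)) (r i))
                                          (sum-cong-≗ λ i → δ-sym (t (a j)) (r i))) ⟩
      sum endpointRows ∎
      where open ≡.≡-Reasoning
    total : sum {k} (λ _ → 2) ≤ sum endpointRows
    total = ≡.subst (sum {k} (λ _ → 2) ≤_) double-count (sum-mono-≤ 2≤deg)
    both-1 : ∀ {p q} → p ≤ 1 → q ≤ 1 → p + q ≡ 2 → 0 < p × 0 < q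
    both-1 z≤n       z≤n       ()
    both-1 z≤n       (s≤s z≤n) ()
    both-1 (s≤s z≤n) z≤n       ()
    both-1 (s≤s z≤n) (s≤s z≤n) _ = s≤s z≤n , s≤s z≤n
  ... | 0<o , 0<t = rowCount>0⇒ r _ 0<o , rowCount>0⇒ r _ 0<t

module Arborescences {n m : ℕ} (X : Graph n m) where
  open import Data.Nat using (_+_)
  open Graph X
  open Edges X
  open import Induction.WellFounded using (Acc; acc)
  open import Data.Nat.Induction using (<-wellFounded)
  import Relation.Binary.Construct.On as On
  open import Function using (_on_)

  -- When the rows are all vertices but v, this is Ã oriented towards v.
  record Arborescence {k} (height : Fin n → ℕ) (r : Fin k → Fin n) (a : Fin k → Fin m) : Set where
    field
      childRow           : Fin k → Fin k
      childRow-injective : Injective _≡_ _≡_ childRow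
      parent             : Fin k → Fin n
      joins              : ∀ j → Joins (a j) (r (childRow j)) (parent j)
      descends           : ∀ j → height (parent j) < height (r (childRow j))

    child : Fin k → Fin n
    child j = r (childRow j)

    child-injective : Injective _≡_ _≡_ r → Injective _≡_ _≡_ child
    child-injective r-inj = childRow-injective ∘ r-inj

    parent≢child : ∀ j → parent j ≢ child j
    parent≢child j eq = ℕ.<-irrefl (≡.cong height eq) (descends j)

    descendingEdge : ∀ j → ∃ λ e → Orientation (a j) e × o e ≡ child j × t e ≡ parent j
    descendingEdge j with joins j
    ... | inj₁ (o≡child , t≡parent) = a j , inj₁ ≡.refl , o≡child , t≡parent
    ... | inj₂ (o≡parent , t≡child) = bar (a j) , inj₂ (≡.sym (bar-inv (a j))) ,
                                      ≡.trans (o-bar (a j)) t≡child , ≡.trans (t-bar (a j)) o≡parent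

  removeColumn : ∀ {k h} {r : Fin (suc k) → Fin n} {a : Fin (suc k) → Fin m} →
                 (A : Arborescence h r a) → ∀ j₀ →
                 Arborescence h (r ∘ punchIn (Arborescence.childRow A j₀)) (a ∘ punchIn j₀)
  removeColumn {h = h} {r} A j₀ = record
    { childRow           = λ j → punchOut (i₀≢ j)
    ; childRow-injective = λ eq →
        punchIn-injective j₀ _ _ (childRow-injective (punchOut-injective (i₀≢ _) (i₀≢ _) eq))
    ; parent             = parent ∘ punchIn j₀
    ; joins              = λ j → ≡.subst (λ i → Joins _ (r i) _) (punchIn∘punchOut j) (joins (punchIn j₀ j))
    ; descends           = λ j → ≡.subst (λ i → _ < h (r i)) (punchIn∘punchOut j) (descends (punchIn j₀ j))
    }
    where
    open Arborescence A
    i₀≢ : ∀ j → childRow j₀ ≢ childRow (punchIn j₀ j)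
    i₀≢ j eq = punchInᵢ≢i j₀ j (≡.sym (childRow-injective eq))
    punchIn∘punchOut : ∀ j → childRow (punchIn j₀ j) ≡ punchIn (childRow j₀) (punchOut (i₀≢ j))
    punchIn∘punchOut j = ≡.sym (punchIn-punchOut (i₀≢ j))

  addLeaf : ∀ {k h} {r : Fin (suc k) → Fin n} {a : Fin (suc k) → Fin m} i₀ j₀ {y} →
            Joins (a j₀) (r i₀) y → y ≢ r i₀ → (∀ j′ → NotIncident (a (punchIn j₀ j′)) (r i₀)) →
            Arborescence h (r ∘ punchIn i₀) (a ∘ punchIn j₀) →
            Arborescence (updateAt h (r i₀) λ _ → suc (h y)) r a
  addLeaf {h = h} {r} {a} i₀ j₀ {y} leaf y≢leaf others A = record
    { childRow = childRow ; childRow-injective = childRow-injective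
    ; parent = parent ; joins = joins ; descends = descends }
    where
    module A = Arborescence A
    childRow = insertAt (punchIn i₀ ∘ A.childRow) j₀ i₀
    parent   = insertAt A.parent j₀ y
    h′       = updateAt h (r i₀) λ _ → suc (h y)

    unchanged : ∀ {x} → x ≢ r i₀ → h′ x ≡ h x
    unchanged x≢leaf = updateAt-minimal _ (r i₀) h x≢leaf

    childRow-injective : Injective _≡_ _≡_ childRow
    childRow-injective =
      insertAt-injective (A.childRow-injective ∘ punchIn-injective i₀ _ _) j₀ (punchInᵢ≢i i₀ ∘ A.childRow)

    joins : ∀ j → Joins (a j) (r (childRow j)) (parent j)
    joins j with ≡-or-punchIn j₀ j
    ... | inj₁ ≡.refl
      rewrite insertAt-lookup (punchIn i₀ ∘ A.childRow) j₀ i₀ | insertAt-lookup A.parent j₀ y = leaf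
    ... | inj₂ (j′ , ≡.refl)
      rewrite insertAt-punchIn (punchIn i₀ ∘ A.childRow) j₀ i₀ j′ | insertAt-punchIn A.parent j₀ y j′
            = A.joins j′

    descends : ∀ j → h′ (parent j) < h′ (r (childRow j))
    descends j with ≡-or-punchIn j₀ j
    ... | inj₁ ≡.refl
      rewrite insertAt-lookup (punchIn i₀ ∘ A.childRow) j₀ i₀ | insertAt-lookup A.parent j₀ y
            | unchanged y≢leaf | updateAt-updates (r i₀) {λ _ → suc (h y)} h = ℕ.n<1+n (h y)
    ... | inj₂ (j′ , ≡.refl)
      rewrite insertAt-punchIn (punchIn i₀ ∘ A.childRow) j₀ i₀ j′ | insertAt-punchIn A.parent j₀ y j′
      with child≢leaf , parent≢leaf ← joins-notIncident (others j′) (A.joins j′)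
      rewrite unchanged child≢leaf | unchanged parent≢leaf = A.descends j′

  -- A cycle would have to leave its highest vertex x along two different edges, but both
  -- would then be the unique column whose child is x.
  arborescence⇒tree : ∀ {k h} {r : Fin k → Fin n} {a : Fin k → Fin m} v → Injective _≡_ _≡_ r →
                      (∀ x → x ≡ v ⊎ ∃ λ i → r i ≡ x) → Arborescence h r a → IsTree X (Tilde X a)
  arborescence⇒tree {h = h} {r} {a} v r-inj cover A = connected , acyclic
    where
    open Arborescence A
    open import Data.Fin.Relation.Unary.Top using (view; ‵fromℕ; ‵inject₁)
    open import Data.Fin using (fromℕ; inject₁)

    toRoot : ∀ x → Acc (_<_ on h) x → ∃ λ k → Walk X (Tilde X a) x v k
    toRoot x (acc lower) with cover x
    ... | inj₁ ≡.refl       = 0 , nil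
    ... | inj₂ (i , ≡.refl) with j , ≡.refl ← injective⇒surjective childRow childRow-injective i
                            with e , orient , o≡child , t≡parent ← descendingEdge j
                            with k , W ← toRoot (parent j) (lower (descends j)) =
      suc k , ≡.subst (λ y → Walk X (Tilde X a) y v (suc k)) o≡child
                (cons e (Tilde-intro a j orient)
                      (≡.subst (λ y → Walk X (Tilde X a) y v k) (≡.sym t≡parent) W))

    connected : Connected X (Tilde X a)
    connected x y with k , W ← toRoot x (On.wellFounded h <-wellFounded x)
                  with l , W′ ← toRoot y (On.wellFounded h <-wellFounded y) =
      k + l , W ++ reverse (Tilde-bar a) W′

    acyclic : ∀ l c → ¬ IsCycle X (Tilde X a) l c
    acyclic l c (c∈ , consecutive , closing , distinct , _) = contradiction
      where
      successor : ∀ i → ∃ λ i′ → t (c i) ≡ o (c i′)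
      successor i with view i
      ... | ‵fromℕ      = zero , closing
      ... | ‵inject₁ i′ = suc i′ , consecutive i′
      predecessor : ∀ i → ∃ λ i′ → t (c i′) ≡ o (c i)
      predecessor zero    = fromℕ l , closing
      predecessor (suc i) = inject₁ i , consecutive i
      i* = proj₁ (argmax λ i → h (o (c i)))
      x = o (c i*)
      highest : ∀ i → h (o (c i)) ≤ h x
      highest = proj₂ (argmax λ i → h (o (c i)))
      childOf : ∀ j {y} → Joins (a j) x y → h y ≤ h x → child j ≡ x × parent j ≡ y
      childOf j joinsʲ y≤x = joins-descending h (joins j) joinsʲ (descends j) y≤x
      contradiction : ⊥
      contradiction
        with next , t≡next ← successor i* | ip , t≡x ← predecessor i*
        with j₁ , orient₁ ← Tilde-elim a (c∈ i*) | j₂ , orient₂ ← Tilde-elim a (c∈ ip)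
        with child₁ , parent₁ ← childOf j₁ (orientation⇒joins orient₁)
                                  (≡.subst (λ z → h z ≤ h x) (≡.sym t≡next) (highest next))
        with child₂ , _ ← childOf j₂ (≡.subst (λ z → Joins (a j₂) z (o (c ip))) t≡x
                                        (swap (orientation⇒joins orient₂)))
                                     (highest ip)
        with ≡.refl ← child-injective r-inj (≡.trans child₁ (≡.sym child₂))
        with ip ≟ i*
      ... | yes ≡.refl = parent≢child j₁ (≡.trans parent₁ (≡.trans t≡x (≡.sym child₁)))
      ... | no ip≢i* with distinct i* ip (ip≢i* ∘ ≡.sym) | orientations orient₁ orient₂
      ...   | c≢c , _ | inj₁ same     = c≢c same
      ...   | _ , c≢c̄ | inj₂ reversed = c≢c̄ reversed

  -- The parent of a row vertex x ≠ v is its neighbour on a shortest walk to v; distinct rows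
  -- get distinct columns this way, and there are as many columns as rows.
  distance⇒arborescence : ∀ {k v d} {r : Fin k → Fin n} {a : Fin k → Fin m} → Injective _≡_ _≡_ r →
                          (∀ i → r i ≢ v) → IsDistFrom X (Tilde X a) v d → Arborescence d r a
  distance⇒arborescence {k} {v} {d} {r} {a} r-inj r≢v dist = record
    { childRow = childRow ; childRow-injective = childRow-injective
    ; parent = parent ; joins = joins ; descends = descends }
    where
    closerNeighbour : ∀ i → ∃₂ λ j y → Joins (a j) (r i) y × d y < d (r i)
    closerNeighbour i
      with e , e∈ , o≡rᵢ , k′ , d≡1+k′ , W ← firstEdge (reverse (Tilde-bar a) (proj₁ (dist (r i)))) (r≢v i)
      with j , orient ← Tilde-elim a e∈ =
      j , t e , ≡.subst (λ x → Joins (a j) x (t e)) o≡rᵢ (orientation⇒joins orient) ,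
      ℕ.≤-<-trans (proj₂ (dist (t e)) k′ (reverse (Tilde-bar a) W))
                  (≡.subst (k′ <_) (≡.sym d≡1+k′) (ℕ.n<1+n k′))
    parentColumn : Fin k → Fin k
    parentColumn i = proj₁ (closerNeighbour i)
    neighbour : Fin k → Fin n
    neighbour i = proj₁ (proj₂ (closerNeighbour i))
    neighbour-joins : ∀ i → Joins (a (parentColumn i)) (r i) (neighbour i)
    neighbour-joins i = proj₁ (proj₂ (proj₂ (closerNeighbour i)))
    neighbour-closer : ∀ i → d (neighbour i) < d (r i)
    neighbour-closer i = proj₂ (proj₂ (proj₂ (closerNeighbour i)))
    parentColumn-injective : Injective _≡_ _≡_ parentColumn
    parentColumn-injective {i} {i′} eq = r-inj (proj₁ (joins-descending d (neighbour-joins i)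
      (≡.subst (λ j → Joins (a j) (r i′) (neighbour i′)) (≡.sym eq) (neighbour-joins i′))
      (neighbour-closer i) (ℕ.<⇒≤ (neighbour-closer i′))))
    columnHit : ∀ j → ∃ λ i → parentColumn i ≡ j
    columnHit = injective⇒surjective parentColumn parentColumn-injective
    childRow : Fin k → Fin k
    childRow j = proj₁ (columnHit j)
    childRow-injective : Injective _≡_ _≡_ childRow
    childRow-injective {j} {j′} eq =
      ≡.trans (≡.sym (proj₂ (columnHit j))) (≡.trans (≡.cong parentColumn eq) (proj₂ (columnHit j′)))
    parent : Fin k → Fin n
    parent j = neighbour (childRow j)
    joins : ∀ j → Joins (a j) (r (childRow j)) (parent j)
    joins j = ≡.subst (λ j′ → Joins (a j′) (r (childRow j)) (parent j)) (proj₂ (columnHit j))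
                      (neighbour-joins (childRow j))
    descends : ∀ j → d (parent j) < d (r (childRow j))
    descends j = neighbour-closer (childRow j)

module IncidenceMatrix {c ℓ} (R : CommutativeRing c ℓ) {n m : ℕ} (X : Graph n m) where
  open CommutativeRing R hiding (zero)
  open RingDefs R using (Bmat; det; altSum)
  open Graph X
  open Determinant R
  open Edges X
  open Degrees X
  open Arborescences X
  open import Algebra.Properties.Ring ring using (-1*x≈-x)
  open import Algebra.Properties.Semiring.Exp semiring using (_^_; ^-homo-*)
  open import Algebra.Properties.Semiring.Sum semiring using (sum; sum-remove)
  open import Algebra.Properties.CommutativeMonoid.Sum *-commutativeMonoid
    using () renaming ( sum to ∏; sum-remove to ∏-remove; sum-cong-≋ to ∏-cong
                      ; ∑-distrib-+ to ∏-distrib-*; sum-replicate-zero to ∏-ones)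
  open FinSum +-commutativeMonoid using (sum-single)
  open FinSum *-commutativeMonoid
    using () renaming (sum-single to ∏-single; sum-vanishing-off-image to ∏-vanishing-off-image)
  open import Algebra.Solver.Ring.NaturalCoefficients.Default commutativeSemiring using (solve; _:*_; _:=_)
  open import Relation.Binary.Reasoning.Setoid setoid

  B : ∀ {k} → (Fin n → Carrier) → (Fin k → Fin n) → (Fin k → Fin m) → Matrix k
  B s r a i j = Bmat X s (r i) (a j)

  ones : Fin n → Carrier
  ones _ = 1#

  module _ (s : Fin n → Carrier) {u : Fin n} {e : Fin m} where

    Bmat-loop : o e ≡ t e → Bmat X s u e ≈ 0#
    Bmat-loop loop with o e ≟ t e
    ... | yes _     = refl
    ... | no  o≢t   = ⊥-elim (o≢t loop)

    Bmat-origin : o e ≢ t e → o e ≡ u → Bmat X s u e ≈ s (t e)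
    Bmat-origin o≢t o≡u with o e ≟ t e
    ... | yes o≡t = ⊥-elim (o≢t o≡t)
    ... | no _ with o e ≟ u
    ...   | yes _   = refl
    ...   | no o≢u  = ⊥-elim (o≢u o≡u)

    Bmat-terminus : o e ≢ t e → o e ≢ u → t e ≡ u → Bmat X s u e ≈ - s (o e)
    Bmat-terminus o≢t o≢u t≡u with o e ≟ t e
    ... | yes o≡t = ⊥-elim (o≢t o≡t)
    ... | no _ with o e ≟ u
    ...   | yes o≡u = ⊥-elim (o≢u o≡u)
    ...   | no _ with t e ≟ u
    ...     | yes _   = refl
    ...     | no t≢u  = ⊥-elim (t≢u t≡u)

    Bmat-notIncident : NotIncident e u → Bmat X s u e ≈ 0#
    Bmat-notIncident (o≢u , t≢u) with o e ≟ t e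
    ... | yes _ = refl
    ... | no _ with o e ≟ u
    ...   | yes o≡u = ⊥-elim (o≢u o≡u)
    ...   | no _ with t e ≟ u
    ...     | yes t≡u = ⊥-elim (t≢u t≡u)
    ...     | no _    = refl

  Bmat≈Bmat-ones*weight : ∀ s u e → (Bmat X s u e ≈ 0# × Bmat X ones u e ≈ 0#) ⊎
                          ∃ λ y → Joins e u y × Bmat X s u e ≈ Bmat X ones u e * s y
  Bmat≈Bmat-ones*weight s u e with endpointCases
    where
    endpointCases : o e ≡ t e ⊎ o e ≢ t e × (o e ≡ u ⊎ o e ≢ u × t e ≡ u ⊎ NotIncident e u)
    endpointCases with o e ≟ t e | o e ≟ u | t e ≟ u
    ... | yes loop | _       | _       = inj₁ loop
    ... | no o≢t   | yes o≡u | _       = inj₂ (o≢t , inj₁ o≡u)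
    ... | no o≢t   | no o≢u  | yes t≡u = inj₂ (o≢t , inj₂ (inj₁ (o≢u , t≡u)))
    ... | no o≢t   | no o≢u  | no t≢u  = inj₂ (o≢t , inj₂ (inj₂ (o≢u , t≢u)))
  ... | inj₁ loop = inj₁ (Bmat-loop s loop , Bmat-loop ones loop)
  ... | inj₂ (o≢t , inj₁ ≡.refl) = inj₂ (t e , inj₁ (≡.refl , ≡.refl) ,
          trans (Bmat-origin s o≢t ≡.refl) (sym (trans (*-congʳ (Bmat-origin ones o≢t ≡.refl)) (*-identityˡ _))))
  ... | inj₂ (o≢t , inj₂ (inj₁ (o≢u , ≡.refl))) = inj₂ (o e , inj₂ (≡.refl , ≡.refl) ,
          trans (Bmat-terminus s o≢t o≢u ≡.refl) (sym (trans (*-congʳ (Bmat-terminus ones o≢t o≢u ≡.refl))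
                                                              (-1*x≈-x _))))
  ... | inj₂ (_ , inj₂ (inj₂ notIncident)) =
          inj₁ (Bmat-notIncident s notIncident , Bmat-notIncident ones notIncident)

  Bmat-square : ∀ s {e u y} → Joins e u y → u ≢ y → Bmat X s u e * Bmat X s u e ≈ s y * s y
  Bmat-square s (inj₁ (≡.refl , ≡.refl)) u≢y = *-cong entry entry
    where entry = Bmat-origin s u≢y ≡.refl
  Bmat-square s (inj₂ (≡.refl , ≡.refl)) u≢y = trans (*-cong entry entry) (neg-square _)
    where entry = Bmat-terminus s (u≢y ∘ ≡.sym) (u≢y ∘ ≡.sym) ≡.refl

  weightFactor : ∀ {k} → (Fin n → Carrier) → (Fin k → Fin n) → (Fin k → Fin m) → Carrier
  weightFactor s r a = ∏ λ x → s x ^ exponent r a x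

  weightFactor-removeColumn : ∀ {k} s (r : Fin (suc k) → Fin n) (a : Fin (suc k) → Fin m) j {y} →
                              Joins (a j) (r zero) y → rowCount (r ∘ suc) y ≤ degree (a ∘ punchIn j) y →
                              weightFactor s r a ≈ s y * weightFactor s (r ∘ suc) (a ∘ punchIn j)
  weightFactor-removeColumn s r a j {y} joinsʲ rows≤deg = begin
    ∏ (λ x → s x ^ exponent r a x)
      ≈⟨ ∏-cong (λ x → trans (reflexive (≡.cong (s x ^_) (exponent-removeColumn r a j joinsʲ rows≤deg x)))
                             (^-homo-* (s x) (δ y x) _)) ⟩
    ∏ (λ x → s x ^ δ y x * s x ^ exponent r′ a′ x)
      ≈⟨ ∏-distrib-* (λ x → s x ^ δ y x) (λ x → s x ^ exponent r′ a′ x) ⟩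
    ∏ (λ x → s x ^ δ y x) * weightFactor s r′ a′
      ≈⟨ *-congʳ (trans (∏-single _ y λ x x≢y → reflexive (≡.cong (s x ^_) (δ-≢ (x≢y ∘ ≡.sym))))
                        at-y) ⟩
    s y * weightFactor s r′ a′ ∎
    where
    r′ = r ∘ suc
    a′ = a ∘ punchIn j
    at-y : s y ^ δ y y ≈ s y
    at-y = trans (reflexive (≡.cong (s y ^_) (δ-refl y))) (*-identityʳ (s y))

  det-B-isolatedRow : ∀ k s (r : Fin k → Fin n) (a : Fin k → Fin m) i → degree a (r i) ≡ 0 →
                      det k (B s r a) ≈ 0#
  det-B-isolatedRow k s r a i deg≡0 =
    det-zeroRow k i (B s r a) λ j → Bmat-notIncident s (degree≡0⇒ a (r i) deg≡0 j)

  -- Each term of det (B s r a) is the corresponding term of det (B ones r a) times the weights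
  -- of the column ends not used as rows; for every nonvanishing term that is weightFactor s r a.
  det-B≈det-B-ones*weightFactor : ∀ k (r : Fin k → Fin n) (a : Fin k → Fin m) → Injective _≡_ _≡_ r → ∀ s →
                                  det k (B s r a) ≈ det k (B ones r a) * weightFactor s r a
  det-B≈det-B-ones*weightFactor zero    r a r-inj s = sym (trans (*-identityˡ _) (∏-ones n))
  det-B≈det-B-ones*weightFactor (suc k) r a r-inj s = begin
    altSum (λ j → Bmat X s (r zero) (a j) * det k (B s r′ (a′ j)))
      ≈⟨ altSum-cong term ⟩
    altSum (λ j → (Bmat X ones (r zero) (a j) * det k (B ones r′ (a′ j))) * Φ)
      ≈⟨ sym (*-distribʳ-altSum Φ λ j → Bmat X ones (r zero) (a j) * det k (B ones r′ (a′ j))) ⟩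
    det (suc k) (B ones r a) * Φ ∎
    where
    Φ  = weightFactor s r a
    r′ = r ∘ suc
    a′ : Fin (suc k) → Fin k → Fin m
    a′ j = a ∘ punchIn j
    IH : ∀ j → det k (B s r′ (a′ j)) ≈ det k (B ones r′ (a′ j)) * weightFactor s r′ (a′ j)
    IH j = det-B≈det-B-ones*weightFactor k r′ (a′ j) (suc-injective ∘ r-inj) s
    term : ∀ j → Bmat X s (r zero) (a j) * det k (B s r′ (a′ j)) ≈
           (Bmat X ones (r zero) (a j) * det k (B ones r′ (a′ j))) * Φ
    term j with Bmat≈Bmat-ones*weight s (r zero) (a j)
    ... | inj₁ (Bs≈0 , B₁≈0) =
      trans (x≈0⇒x*y≈0 _ Bs≈0) (sym (x≈0⇒x*y≈0 Φ (x≈0⇒x*y≈0 _ B₁≈0)))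
    ... | inj₂ (y , joinsʲ , Bs≈B₁*sy) with rowCount r′ y ≤? degree (a′ j) y
    ...   | yes rows≤deg = begin
      Bmat X s (r zero) (a j) * det k (B s r′ (a′ j))
        ≈⟨ *-cong Bs≈B₁*sy (IH j) ⟩
      (B₁ * s y) * (D₁ * Φ′)
        ≈⟨ solve 4 (λ b w d f → (b :* w) :* (d :* f) := (b :* d) :* (w :* f)) refl B₁ (s y) D₁ Φ′ ⟩
      (B₁ * D₁) * (s y * Φ′)
        ≈⟨ *-congˡ (sym (weightFactor-removeColumn s r a j joinsʲ rows≤deg)) ⟩
      (B₁ * D₁) * Φ ∎
      where
      B₁ = Bmat X ones (r zero) (a j)
      D₁ = det k (B ones r′ (a′ j))
      Φ′ = weightFactor s r′ (a′ j)
    ...   | no rows≰deg =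
      trans (y≈0⇒x*y≈0 _ (trans (IH j) (x≈0⇒x*y≈0 _ D₁≈0)))
            (sym (x≈0⇒x*y≈0 Φ (y≈0⇒x*y≈0 _ D₁≈0)))
      where
      -- here the other end y of the column is a row of the minor not met by its columns
      deg<rows : degree (a′ j) y < rowCount r′ y
      deg<rows = ℕ.≰⇒> rows≰deg
      D₁≈0 : det k (B ones r′ (a′ j)) ≈ 0#
      D₁≈0 with i , r′i≡y ← rowCount>0⇒ r′ y (ℕ.≤-<-trans z≤n deg<rows) =
        det-B-isolatedRow k ones r′ (a′ j) i (≡.subst (λ x → degree (a′ j) x ≡ 0) (≡.sym r′i≡y)
          (ℕ.n≤0⇒n≡0 (ℕ.≤-pred (ℕ.≤-trans deg<rows
            (rowCount≤1 r′ (suc-injective ∘ r-inj) y)))))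

  columnSum-B-ones≈0 : ∀ {k} (r : Fin k → Fin n) → Injective _≡_ _≡_ r → ∀ {e i₁ i₂} → o e ≢ t e →
                       r i₁ ≡ o e → r i₂ ≡ t e → sum (λ i → Bmat X ones (r i) e) ≈ 0#
  columnSum-B-ones≈0 {suc k} r r-inj {e} {i₁} {i₂} o≢t r₁≡o r₂≡t = begin
    sum f
      ≈⟨ sum-remove {i = i₁} f ⟩
    f i₁ + sum (f ∘ punchIn i₁)
      ≈⟨ +-congˡ (sum-single (f ∘ punchIn i₁) (punchOut i₁≢i₂) others≈0) ⟩
    f i₁ + f (punchIn i₁ (punchOut i₁≢i₂))
      ≈⟨ +-cong (Bmat-origin ones o≢t (≡.sym r₁≡o))
                (trans (reflexive (≡.cong f (punchIn-punchOut i₁≢i₂)))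
                       (Bmat-terminus ones o≢t (λ o≡r₂ → o≢t (≡.trans o≡r₂ r₂≡t)) (≡.sym r₂≡t))) ⟩
    1# - 1#
      ≈⟨ -‿inverseʳ 1# ⟩
    0# ∎
    where
    f = λ i → Bmat X ones (r i) e
    i₁≢i₂ : i₁ ≢ i₂
    i₁≢i₂ i₁≡i₂ = o≢t (≡.trans (≡.sym r₁≡o) (≡.trans (≡.cong r i₁≡i₂) r₂≡t))
    others≈0 : ∀ x → x ≢ punchOut i₁≢i₂ → f (punchIn i₁ x) ≈ 0#
    others≈0 x x≢ = Bmat-notIncident ones
      ( (λ o≡ → punchInᵢ≢i i₁ x (r-inj (≡.trans (≡.sym o≡) (≡.sym r₁≡o))))
      , (λ t≡ → x≢ (punchIn-injective i₁ _ _ (≡.trans (r-inj (≡.trans (≡.sym t≡) (≡.sym r₂≡t)))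
                                                      (≡.sym (punchIn-punchOut i₁≢i₂))))) )

  -- Strip leaves, rows met by a single column, by Laplace expansion; what remains is either
  -- empty, or has an isolated row, or has every column inside the rows, so that its rows sum to 0.
  det-B-ones≈0⊎arborescence : ∀ k (r : Fin k → Fin n) (a : Fin k → Fin m) → Injective _≡_ _≡_ r →
                              (∀ j → o (a j) ≢ t (a j)) →
                              det k (B ones r a) ≈ 0# ⊎ ∃ λ h → Arborescence h r a
  det-B-ones≈0⊎arborescence zero    r a r-inj loopless = inj₂ ((λ _ → 0) , record
    { childRow = λ () ; childRow-injective = λ { {()} } ; parent = λ () ; joins = λ () ; descends = λ () })
  det-B-ones≈0⊎arborescence (suc k) r a r-inj loopless with any? (λ i → degree a (r i) ≤? 1)
  ... | no noLeaf = inj₁ (det-columnSums≈0 k (B ones r a) λ j →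
        let (i₁ , r₁≡o) , (i₂ , r₂≡t) = coreColumns r a r-inj (λ i → ℕ.≰⇒> (noLeaf ∘ (i ,_))) j
        in columnSum-B-ones≈0 r r-inj (loopless j) r₁≡o r₂≡t)
  ... | yes (i₀ , deg≤1) with ℕ.n≤1⇒n≡0∨n≡1 deg≤1
  ...   | inj₁ deg≡0 = inj₁ (det-B-isolatedRow (suc k) ones r a i₀ deg≡0)
  ...   | inj₂ deg≡1
    with j₀ , y , leaf , y≢leaf , others ← degree≡1⇒leaf a (r i₀) deg≡1
    with det-B-ones≈0⊎arborescence k (r ∘ punchIn i₀) (a ∘ punchIn j₀) (punchIn-injective i₀ _ _ ∘ r-inj)
                                   (loopless ∘ punchIn j₀)
  ...     | inj₁ minor≈0 = inj₁ (det-singleEntryRow-≈0 k (B ones r a) i₀ j₀ onlyEntry minor≈0)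
    where
    onlyEntry : ∀ j → j ≢ j₀ → Bmat X ones (r i₀) (a j) ≈ 0#
    onlyEntry j j≢j₀ with ≡-or-punchIn j₀ j
    ... | inj₁ j≡j₀           = ⊥-elim (j≢j₀ j≡j₀)
    ... | inj₂ (j′ , ≡.refl) = Bmat-notIncident ones (others j′)
  ...     | inj₂ (_ , A) = inj₂ (_ , addLeaf i₀ j₀ leaf y≢leaf others A)

  ¬tree⇒det-B≈0 : ∀ {k v} (r : Fin k → Fin n) (a : Fin k → Fin m) → Injective _≡_ _≡_ r →
                  (∀ x → x ≡ v ⊎ ∃ λ i → r i ≡ x) → ∀ s → ¬ IsTree X (Tilde X a) →
                  det k (B s r a) ≈ 0#
  ¬tree⇒det-B≈0 {k} {v} r a r-inj cover s ¬tree with any? (λ j → o (a j) ≟ t (a j))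
  ... | yes (j , loop) = det-zeroColumn k j (B s r a) λ i → Bmat-loop s loop
  ... | no noLoop with det-B-ones≈0⊎arborescence k r a r-inj (λ j loop → noLoop (j , loop))
  ...   | inj₁ det-ones≈0 =
    trans (det-B≈det-B-ones*weightFactor k r a r-inj s) (x≈0⇒x*y≈0 _ det-ones≈0)
  ...   | inj₂ (_ , A)    = ⊥-elim (¬tree (arborescence⇒tree v r-inj cover A))

  det-B²≈∏-parent² : ∀ k {h} (r : Fin k → Fin n) (a : Fin k → Fin m) → Injective _≡_ _≡_ r →
                     (A : Arborescence h r a) → ∀ s →
                     let open Arborescence A using (parent) in
                     det k (B s r a) * det k (B s r a) ≈ ∏ λ j → s (parent j) * s (parent j)
  det-B²≈∏-parent² zero    r a r-inj A s = *-identityˡ 1#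
  det-B²≈∏-parent² (suc k) {h} r a r-inj A s = begin
    det (suc k) M * det (suc k) M
      ≈⟨ det-singleEntryRow-square k M i₀ j₀ onlyEntry ⟩
    (M i₀ j₀ * M i₀ j₀) * (det k (minor M i₀ j₀) * det k (minor M i₀ j₀))
      ≈⟨ *-cong (Bmat-square s (joins j₀) (parent≢child j₀ ∘ ≡.sym))
                (det-B²≈∏-parent² k (r ∘ punchIn i₀) (a ∘ punchIn j₀) (punchIn-injective i₀ _ _ ∘ r-inj)
                                  (removeColumn A j₀) s) ⟩
    (s (parent j₀) * s (parent j₀)) * ∏ (λ j → s (parent (punchIn j₀ j)) * s (parent (punchIn j₀ j)))
      ≈⟨ sym (∏-remove {i = j₀} λ j → s (parent j) * s (parent j)) ⟩
    ∏ (λ j → s (parent j) * s (parent j)) ∎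
    where
    open Arborescence A
    M = B s r a
    -- the highest child is a leaf: its row has a single nonzero entry
    j₀ = proj₁ (argmax λ j → h (child j))
    highest : ∀ j → h (child j) ≤ h (child j₀)
    highest = proj₂ (argmax λ j → h (child j))
    i₀ = childRow j₀
    onlyEntry : ∀ j → j ≢ j₀ → M i₀ j ≈ 0#
    onlyEntry j j≢j₀ =
      Bmat-notIncident s (joins⇒notIncident (joins j) (j≢j₀ ∘ child-injective r-inj) parent≢highest)
      where
      parent≢highest : parent j ≢ child j₀
      parent≢highest eq =
        ℕ.<⇒≱ (descends j) (≡.subst (λ x → h (child j) ≤ h x) (≡.sym eq) (highest j))

  prodFin≈∏ : ∀ {k} (f : Fin k → Carrier) → RingDefs.prodFin R f ≈ ∏ f
  prodFin≈∏ {zero}  f = refl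
  prodFin≈∏ {suc k} f = *-congˡ (prodFin≈∏ (f ∘ suc))

  -- The oriented edges counted in w(Ã_v) are exactly the descending orientations of the columns.
  wTv≈∏-parent : ∀ {k d} {r : Fin k → Fin n} {a : Fin k → Fin m} → Injective _≡_ _≡_ r →
                 (A : Arborescence d r a) → ∀ w →
                 RingDefs.wTv R X w a d ≈ ∏ λ j → w (Arborescence.parent A j)
  wTv≈∏-parent {k} {d} {r} {a} r-inj A w = begin
    RingDefs.prodFin R F  ≈⟨ prodFin≈∏ F ⟩
    ∏ F                   ≈⟨ ∏-vanishing-off-image σ σ-injective F outside≈1 ⟩
    ∏ (F ∘ σ)             ≈⟨ ∏-cong onColumn ⟩
    ∏ (w ∘ parent)        ∎
    where
    open Arborescence A
    F : Fin m → Carrier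
    F e = if inTildeᵇ X a e ∧ ⌊ d (t e) <? d (o e) ⌋ then w (t e) else 1#
    F-cases : ∀ e → (Tilde X a e × d (t e) < d (o e) × F e ≡ w (t e)) ⊎
              (¬ (Tilde X a e × d (t e) < d (o e)) × F e ≡ 1#)
    F-cases e with inTildeᵇ X a e | d (t e) <? d (o e)
    ... | true  | yes t<o = inj₁ (_ , t<o , ≡.refl)
    ... | true  | no  t≮o = inj₂ (t≮o ∘ proj₂ , ≡.refl)
    ... | false | _       = inj₂ ((λ ()) ∘ proj₁ , ≡.refl)
    σ : Fin k → Fin m
    σ j = proj₁ (descendingEdge j)
    σ-orientation : ∀ j → Orientation (a j) (σ j)
    σ-orientation j = proj₁ (proj₂ (descendingEdge j))
    o-σ : ∀ j → o (σ j) ≡ child j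
    o-σ j = proj₁ (proj₂ (proj₂ (descendingEdge j)))
    t-σ : ∀ j → t (σ j) ≡ parent j
    t-σ j = proj₂ (proj₂ (proj₂ (descendingEdge j)))
    σ-injective : Injective _≡_ _≡_ σ
    σ-injective {j} {j′} eq =
      child-injective r-inj (≡.trans (≡.sym (o-σ j)) (≡.trans (≡.cong o eq) (o-σ j′)))
    onColumn : ∀ j → F (σ j) ≈ w (parent j)
    onColumn j with F-cases (σ j)
    ... | inj₁ (_ , _ , F≡w) = reflexive (≡.trans F≡w (≡.cong w (t-σ j)))
    ... | inj₂ (notDescending , _) = ⊥-elim (notDescending (Tilde-intro a j (σ-orientation j) ,
          ≡.subst₂ (λ y x → d y < d x) (≡.sym (t-σ j)) (≡.sym (o-σ j)) (descends j)))
    outside≈1 : ∀ e → (∀ j → σ j ≢ e) → F e ≈ 1#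
    outside≈1 e notImage with F-cases e
    ... | inj₂ (_ , F≡1) = reflexive F≡1
    ... | inj₁ (e∈ , t<o , _)
      with j , orient ← Tilde-elim a e∈
      with _ , parent≡t ← joins-descending d (joins j) (orientation⇒joins orient) (descends j) (ℕ.<⇒≤ t<o)
      with orientations (σ-orientation j) orient
    ...   | inj₁ σ≡e = ⊥-elim (notImage j σ≡e)
    ...   | inj₂ σ≡ē = ⊥-elim (parent≢child j
            (≡.trans parent≡t (≡.trans (≡.sym (o-bar e)) (≡.trans (≡.cong o (≡.sym σ≡ē)) (o-σ j)))))

module _ {c ℓ c′ ℓ′} (K : CommutativeRing c ℓ) (L : CommutativeRing c′ ℓ′)
         {ι : CommutativeRing.Carrier K → CommutativeRing.Carrier L}
         (ι-hom : IsRingHomomorphism (CommutativeRing.rawRing K) (CommutativeRing.rawRing L) ι) where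
  private
    module K = CommutativeRing K
  open CommutativeRing L
  open RingDefs L using (det)
  open IsRingHomomorphism ι-hom using (*-homo; 1#-homo; ⟦⟧-cong)
  open import Algebra.Properties.CommutativeMonoid.Sum K.*-commutativeMonoid using () renaming (sum to ∏ᴷ)
  open import Algebra.Properties.CommutativeMonoid.Sum *-commutativeMonoid using (sum-cong-≋) renaming (sum to ∏)
  open import Relation.Binary.Reasoning.Setoid setoid

  ι-∏ : ∀ {k} (f : Fin k → K.Carrier) → ι (∏ᴷ f) ≈ ∏ (ι ∘ f)
  ι-∏ {zero}  f = 1#-homo
  ι-∏ {suc k} f = trans (*-homo _ _) (*-congˡ (ι-∏ (f ∘ suc)))

  distance⇒det-B²≈ι-wTv : ∀ {n m k v d} (X : Graph n m) {r : Fin k → Fin n} {a : Fin k → Fin m} →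
                          Injective _≡_ _≡_ r → (∀ i → r i ≢ v) → IsDistFrom X (Tilde X a) v d →
                          (w : Fin n → K.Carrier) (s : Fin n → Carrier) → (∀ u → s u * s u ≈ ι (w u)) →
                          let open IncidenceMatrix L X using (B) in
                          det k (B s r a) * det k (B s r a) ≈ ι (RingDefs.wTv K X w a d)
  distance⇒det-B²≈ι-wTv {k = k} {d = d} X {r} {a} r-inj r≢v dist w s s²≈ιw = begin
    det k (B s r a) * det k (B s r a)   ≈⟨ det-B²≈∏-parent² k r a r-inj A s ⟩
    ∏ (λ j → s (parent j) * s (parent j)) ≈⟨ sum-cong-≋ (s²≈ιw ∘ parent) ⟩
    ∏ (ι ∘ w ∘ parent)                  ≈⟨ sym (ι-∏ (w ∘ parent)) ⟩
    ι (∏ᴷ (w ∘ parent))                 ≈⟨ ⟦⟧-cong (K.sym (IncidenceMatrix.wTv≈∏-parent K X r-inj A w)) ⟩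
    ι (RingDefs.wTv K X w a d)          ∎
    where
    open IncidenceMatrix L X using (B; det-B²≈∏-parent²)
    open Arborescences X using (Arborescence; distance⇒arborescence)
    A = distance⇒arborescence r-inj r≢v dist
    open Arborescence A using (parent)

mainTheorem10 : ∀ {c ℓ c' ℓ'} (K : CommutativeRing c ℓ) (L : CommutativeRing c' ℓ') →
  IsField K → IsField L →
  (ι : CommutativeRing.Carrier K → CommutativeRing.Carrier L) →
  IsRingHomomorphism (CommutativeRing.rawRing K) (CommutativeRing.rawRing L) ι →
  ∀ {p m : ℕ} (X : Graph (suc p) m) → Connected X (λ _ → ⊤) →
  (w : Fin (suc p) → CommutativeRing.Carrier K) →
  (sq : Fin (suc p) → CommutativeRing.Carrier L) →
  (∀ u → CommutativeRing._≈_ L (CommutativeRing._*_ L (sq u) (sq u)) (ι (w u))) →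
  (S : Fin m → Bool) → (∀ e → S (Graph.bar X e) ≡ not (S e)) →
  (v : Fin (suc p)) →
  (a : Fin p → Fin m) → (∀ i j → a i ≡ a j → i ≡ j) → (∀ j → S (a j) ≡ true) →
  (¬ IsTree X (Tilde X a) →
    CommutativeRing._≈_ L (RingDefs.det L p (RingDefs.subB L X sq v a))
                          (CommutativeRing.0# L))
  ×
  (IsTree X (Tilde X a) → (d : Fin (suc p) → ℕ) → IsDistFrom X (Tilde X a) v d →
    CommutativeRing._≈_ L
      (CommutativeRing._*_ L (RingDefs.det L p (RingDefs.subB L X sq v a))
                             (RingDefs.det L p (RingDefs.subB L X sq v a)))
      (ι (RingDefs.wTv K X w a d)))
mainTheorem10 K L _ _ ι ι-hom X _ w sq sq²≈ιw _ _ v a _ _ =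
  ¬tree⇒det-B≈0 (punchIn v) a rows-injective (≡-or-punchIn v) sq ,
  λ _ _ dist → distance⇒det-B²≈ι-wTv K L ι-hom X rows-injective (punchInᵢ≢i v) dist w sq sq²≈ιw
  where
  open IncidenceMatrix L X using (¬tree⇒det-B≈0)
  rows-injective : Injective _≡_ _≡_ (punchIn v)
  rows-injective = punchIn-injective v _ _
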